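{- Let $\ell$ be an odd prime. The set of indices $[N_s(\ell):G]$ of subgroups $G\le N_s(\ell)$ that belong to $C_s(\ell)$ is the set of positive integers $n$ such that $2\mid n$ and $n\mid 2(\ell-1)^2/q$ for some prime $q$ dividing $\ell-1$.
   Context: $C_s(\ell)$ is the group of invertible diagonal matrices in $\operatorname{GL}_2(\mathbb{Z}/\ell\mathbb{Z})$, $N_s(\ell)=C_s(\ell)\cup\begin{pmatrix}0&1\\1&0\end{pmatrix}C_s(\ell)$, and $Z(\ell)$ the scalar matrices. A subgroup belongs to $C_s(\ell)$ if it is conjugate in $\operatorname{GL}_2(\mathbb{Z}/\ell\mathbb{Z})$ to a subgroup of $C_s(\ell)$ but not to a subgroup of $Z(\ell)$. -}

module Defs where

open import Data.Nat using (ℕ; zero; suc; _+_; _*_; _∸_; NonZero)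
open import Data.Nat.DivMod using (_mod_)
open import Data.Fin using (Fin; toℕ)
open import Data.Fin.Properties using (_≟_)
open import Data.Bool using (Bool; true; false; _∧_; _∨_; not; T)
open import Data.List using (List; []; _∷_; allFin; concatMap; map)
open import Data.Product using (_×_; ∃)
open import Relation.Binary.PropositionalEquality using (_≡_; _≢_)
open import Relation.Nullary using (¬_)
open import Relation.Nullary.Decidable using (⌊_⌋)

-- 2x2 matrices  (a b ; c d)  over ℤ/ℓℤ, entries represented by Fin ℓ
record Mat (ℓ : ℕ) : Set where
  constructor mat
  field
    a b c d : Fin ℓ

module _ (ℓ : ℕ) .{{_ : NonZero ℓ}} where

  _+ₗ_ : Fin ℓ → Fin ℓ → Fin ℓ
  x +ₗ y = (toℕ x + toℕ y) mod ℓ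

  _*ₗ_ : Fin ℓ → Fin ℓ → Fin ℓ
  x *ₗ y = (toℕ x * toℕ y) mod ℓ

  negₗ : Fin ℓ → Fin ℓ
  negₗ x = (ℓ ∸ toℕ x) mod ℓ

  0ₗ 1ₗ : Fin ℓ
  0ₗ = 0 mod ℓ
  1ₗ = 1 mod ℓ

  mul : Mat ℓ → Mat ℓ → Mat ℓ
  mul (mat a b c d) (mat a' b' c' d') =
    mat ((a *ₗ a') +ₗ (b *ₗ c')) ((a *ₗ b') +ₗ (b *ₗ d'))
        ((c *ₗ a') +ₗ (d *ₗ c')) ((c *ₗ b') +ₗ (d *ₗ d'))

  idM : Mat ℓ
  idM = mat 1ₗ 0ₗ 0ₗ 1ₗ

  wM : Mat ℓ
  wM = mat 0ₗ 1ₗ 1ₗ 0ₗ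

  det : Mat ℓ → Fin ℓ
  det (mat a b c d) = (a *ₗ d) +ₗ negₗ (b *ₗ c)

  _==_ : Fin ℓ → Fin ℓ → Bool
  x == y = ⌊ x ≟ y ⌋

  isGLᵇ : Mat ℓ → Bool
  isGLᵇ m = not (det m == 0ₗ)

  isCsᵇ : Mat ℓ → Bool
  isCsᵇ m = (Mat.b m == 0ₗ) ∧ (Mat.c m == 0ₗ) ∧ isGLᵇ m

  isZᵇ : Mat ℓ → Bool
  isZᵇ m = isCsᵇ m ∧ (Mat.a m == Mat.d m)

  -- N_s(ℓ) = C_s(ℓ) ∪ w C_s(ℓ)   (w = (0 1 ; 1 0)); note w·diag(x,y) = (0 y ; x 0)
  isNsᵇ : Mat ℓ → Bool
  isNsᵇ m = isCsᵇ m ∨ ((Mat.a m == 0ₗ) ∧ (Mat.d m == 0ₗ) ∧ isGLᵇ m)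

  allMat : List (Mat ℓ)
  allMat = concatMap (λ a → concatMap (λ b → concatMap (λ c → map (λ d → mat a b c d)
             (allFin ℓ)) (allFin ℓ)) (allFin ℓ)) (allFin ℓ)

  countᵇ : (Mat ℓ → Bool) → List (Mat ℓ) → ℕ
  countᵇ P [] = 0
  countᵇ P (x ∷ xs) with P x
  ... | true  = suc (countᵇ P xs)
  ... | false = countᵇ P xs

  card : (Mat ℓ → Bool) → ℕ
  card P = countᵇ P allMat

  record IsSubgroupNs (G : Mat ℓ → Bool) : Set where
    field
      ⊆Ns   : ∀ g → T (G g) → T (isNsᵇ g)
      hasId : T (G idM)
      mulCl : ∀ g h → T (G g) → T (G h) → T (G (mul g h))
      invCl : ∀ g → T (G g) → ∃ λ h → T (G h) × mul g h ≡ idM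

  ConjInto : (Mat ℓ → Bool) → (Mat ℓ → Bool) → Set
  ConjInto G H = ∃ λ X → ∃ λ Y → mul X Y ≡ idM × mul Y X ≡ idM ×
                   (∀ g → T (G g) → T (H (mul (mul X g) Y)))

  BelongsCs : (Mat ℓ → Bool) → Set
  BelongsCs G = ConjInto G isCsᵇ × ¬ ConjInto G isZᵇ

  IndexNs : (Mat ℓ → Bool) → ℕ → Set
  IndexNs G n = n * card G ≡ card isNsᵇ

module Submission where

-- As |N_s(ℓ)| = 2(ℓ-1)², this is a statement about the possible orders h of G.
-- * If G belongs to C_s(ℓ), conjugation maps G bijectively onto a subgroup of
--   C_s(ℓ), which has (ℓ-1)² elements, so h ∣ (ℓ-1)² by Lagrange's theorem; and
--   h ≥ 2, since the trivial group is conjugate into the scalars Z(ℓ).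
--   Elementary arithmetic turns this into the condition on n = 2(ℓ-1)²/h.
-- * Conversely, such an n equals 2(ℓ-1)²/(d₁d₂) with d₁, d₂ ∣ ℓ - 1 not both 1,
--   and the diagonal group μ_d₁ × μ_d₂ ⊆ C_s(ℓ) realises it: it has d₁d₂
--   elements (|μ_d| = d by Fermat's little theorem and the root bound for
--   polynomials over F_ℓ) and contains a non-scalar matrix.

open import Defs
open import Data.Nat using (ℕ; NonZero)
open import Data.Nat.Primality using (Prime)

module Counting where
  open import Data.Nat using (ℕ; suc; _+_; _*_; _<_; _≤_; z≤n; s≤s)
  import Data.Nat.Properties as ℕP
  open import Data.Nat.ListAction using (sum)
  open import Data.Bool using (Bool; true; false; _∧_; _∨_; not; T; if_then_else_)
  open import Data.Bool.Properties using (T?; T-∧; T-∨)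
  open import Function.Bundles using (Equivalence)
  open import Data.List using (List; []; _∷_; length; map; concatMap; filter; _++_)
  import Data.List.Properties as ListP
  open import Data.List.Membership.Propositional using (_∈_; find)
  open import Data.List.Membership.Propositional.Properties
    using (∈-∃++; ∈-concatMap⁻; ∈-map⁻; ∈-filter⁺; ∈-filter⁻)
  open import Data.List.Relation.Binary.Subset.Propositional using (_⊆_)
  open import Data.List.Relation.Binary.Permutation.Propositional as ↭
    using (_↭_; ↭-refl; ↭-sym; ↭-trans)
  import Data.List.Relation.Binary.Permutation.Propositional.Properties as ↭ₚ
  open import Data.List.Relation.Unary.Any using (here; there)
  open import Data.List.Relation.Unary.All using (All; []; _∷_)
  import Data.List.Relation.Unary.All as All
  open import Data.List.Relation.Unary.Unique.Propositional using (Unique)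
  import Data.List.Relation.Unary.Unique.Propositional.Properties as Unique
  open import Data.List.Relation.Unary.AllPairs using ([]; _∷_)
  open import Data.Product using (_×_; _,_; proj₂; ∃)
  open import Data.Sum using (inj₁)
  open import Data.Empty using (⊥-elim)
  open import Data.Unit using (tt)
  open import Relation.Binary.PropositionalEquality
  open import Relation.Nullary using (¬_)

  T-ext : ∀ {x y} → (T x → T y) → (T y → T x) → x ≡ y
  T-ext {true}  {true}  _ _ = refl
  T-ext {true}  {false} f _ = ⊥-elim (f tt)
  T-ext {false} {true}  _ g = ⊥-elim (g tt)
  T-ext {false} {false} _ _ = refl

  ∧-intro : ∀ {x y} → T x → T y → T (x ∧ y)
  ∧-intro Tx Ty = Equivalence.from T-∧ (Tx , Ty)

  ∧-elim : ∀ {x y} → T (x ∧ y) → T x × T y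
  ∧-elim = Equivalence.to T-∧

  ∨-introˡ : ∀ {x y} → T x → T (x ∨ y)
  ∨-introˡ Tx = Equivalence.from T-∨ (inj₁ Tx)

  not-intro : ∀ {x} → ¬ T x → T (not x)
  not-intro {true}  ¬Tx = ¬Tx tt
  not-intro {false} _   = tt

  not-elim : ∀ {x} → T (not x) → ¬ T x
  not-elim {true} () _

  ∧⁴-intro : ∀ {w x y z} → T w → T x → T y → T z → T (w ∧ (x ∧ (y ∧ z)))
  ∧⁴-intro Tw Tx Ty Tz = ∧-intro Tw (∧-intro Tx (∧-intro Ty Tz))

  ∧⁴-elim : ∀ {w x y z} → T (w ∧ (x ∧ (y ∧ z))) → T w × T x × T y × T z
  ∧⁴-elim t with ∧-elim t
  ... | Tw , t′ with ∧-elim t′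
  ...   | Tx , t″ with ∧-elim t″
  ...     | Ty , Tz = Tw , Tx , Ty , Tz

  module _ {A : Set} where

    count : (A → Bool) → List A → ℕ
    count P [] = 0
    count P (x ∷ xs) with P x
    ... | true  = suc (count P xs)
    ... | false = count P xs

    select : (A → Bool) → List A → List A
    select P = filter (λ x → T? (P x))

    count≡length-select : ∀ P xs → count P xs ≡ length (select P xs)
    count≡length-select P [] = refl
    count≡length-select P (x ∷ xs) with P x
    ... | true  = cong suc (count≡length-select P xs)
    ... | false = count≡length-select P xs

    count-cong : ∀ {P Q} → (∀ x → P x ≡ Q x) → ∀ xs → count P xs ≡ count Q xs
    count-cong P≡Q [] = refl
    count-cong {P} {Q} P≡Q (x ∷ xs) with P x | Q x | P≡Q x
    ... | true  | true  | _ = cong suc (count-cong P≡Q xs)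
    ... | false | false | _ = count-cong P≡Q xs

    count-mono : ∀ {P Q} → (∀ x → T (P x) → T (Q x)) → ∀ xs → count P xs ≤ count Q xs
    count-mono P⇒Q [] = z≤n
    count-mono {P} {Q} P⇒Q (x ∷ xs) with P x | Q x | P⇒Q x
    ... | true  | true  | _ = s≤s (count-mono P⇒Q xs)
    ... | true  | false | f = ⊥-elim (f tt)
    ... | false | true  | _ = ℕP.m≤n⇒m≤1+n (count-mono P⇒Q xs)
    ... | false | false | _ = count-mono P⇒Q xs

    count-∨-≤ : ∀ (P Q : A → Bool) xs → count (λ x → P x ∨ Q x) xs ≤ count P xs + count Q xs
    count-∨-≤ P Q [] = z≤n
    count-∨-≤ P Q (x ∷ xs) with P x | Q x
    ... | true  | true  = s≤s (ℕP.≤-trans (count-∨-≤ P Q xs) (ℕP.+-monoʳ-≤ (count P xs) (ℕP.n≤1+n _)))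
    ... | true  | false = s≤s (count-∨-≤ P Q xs)
    ... | false | true  = subst (suc (count (λ x → P x ∨ Q x) xs) ≤_) (sym (ℕP.+-suc (count P xs) (count Q xs)))
                            (s≤s (count-∨-≤ P Q xs))
    ... | false | false = count-∨-≤ P Q xs

    count-∨-disjoint : ∀ (P Q : A → Bool) → (∀ x → T (P x) → ¬ T (Q x)) → ∀ xs →
                       count (λ x → P x ∨ Q x) xs ≡ count P xs + count Q xs
    count-∨-disjoint P Q disj [] = refl
    count-∨-disjoint P Q disj (x ∷ xs) with P x | Q x | disj x
    ... | true  | true  | f = ⊥-elim (f tt tt)
    ... | true  | false | _ = cong suc (count-∨-disjoint P Q disj xs)
    ... | false | true  | _ = trans (cong suc (count-∨-disjoint P Q disj xs)) (sym (ℕP.+-suc _ _))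
    ... | false | false | _ = count-∨-disjoint P Q disj xs

    count-split : ∀ (P Q : A → Bool) xs → count P xs ≡ count (λ x → P x ∧ Q x) xs + count (λ x → P x ∧ not (Q x)) xs
    count-split P Q [] = refl
    count-split P Q (x ∷ xs) with P x | Q x
    ... | true  | true  = cong suc (count-split P Q xs)
    ... | true  | false = trans (cong suc (count-split P Q xs)) (sym (ℕP.+-suc _ _))
    ... | false | true  = count-split P Q xs
    ... | false | false = count-split P Q xs

    count-const-∧ : ∀ b (P : A → Bool) xs → count (λ x → b ∧ P x) xs ≡ (if b then count P xs else 0)
    count-const-∧ true  P xs       = refl
    count-const-∧ false P []       = refl
    count-const-∧ false P (x ∷ xs) = count-const-∧ false P xs

    count-true : ∀ (xs : List A) → count (λ _ → true) xs ≡ length xs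
    count-true []       = refl
    count-true (x ∷ xs) = cong suc (count-true xs)

    count-witness : ∀ P xs → 0 < count P xs → ∃ λ x → x ∈ xs × T (P x)
    count-witness P (x ∷ xs) pos with P x in eq
    ... | true  = x , here refl , subst T (sym eq) tt
    ... | false with count-witness P xs pos
    ...   | y , y∈xs , Py = y , there y∈xs , Py

    count-pos : ∀ P {xs x} → x ∈ xs → T (P x) → 0 < count P xs
    count-pos P {y ∷ xs} (here refl) Px with P y
    ... | true = s≤s z≤n
    count-pos P {y ∷ xs} (there x∈xs) Px with P y
    ... | true  = s≤s z≤n
    ... | false = count-pos P x∈xs Px

    remove : ∀ {x : A} ys → x ∈ ys → ∃ λ zs → ys ↭ x ∷ zs
    remove ys x∈ys with as , bs , refl ← ∈-∃++ x∈ys = as ++ bs , ↭ₚ.shift _ as bs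

    private
      ⊆-remove : ∀ {x : A} {xs ys zs} → (x ∷ xs) ⊆ ys → All (x ≢_) xs → ys ↭ x ∷ zs → xs ⊆ zs
      ⊆-remove sub x∉xs ys↭ y∈xs with ↭ₚ.∈-resp-↭ ys↭ (sub (there y∈xs))
      ... | here refl = ⊥-elim (All.lookup x∉xs y∈xs refl)
      ... | there y∈zs = y∈zs

    unique-⊆-length : ∀ {xs : List A} ys → Unique xs → xs ⊆ ys → length xs ≤ length ys
    unique-⊆-length {[]}     ys u           sub = z≤n
    unique-⊆-length {x ∷ xs} ys (x∉xs ∷ u) sub with remove ys (sub (here refl))
    ... | zs , ys↭ = subst (suc (length xs) ≤_) (sym (↭ₚ.↭-length ys↭))
                       (s≤s (unique-⊆-length zs u (⊆-remove sub x∉xs ys↭)))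

    unique-⊆-↭ : ∀ {xs : List A} ys → Unique xs → xs ⊆ ys → length ys ≤ length xs → xs ↭ ys
    unique-⊆-↭ {[]}     []       u           sub len = ↭-refl
    unique-⊆-↭ {x ∷ xs} ys       (x∉xs ∷ u) sub len with remove ys (sub (here refl))
    ... | zs , ys↭ = ↭-trans (↭.prep x (unique-⊆-↭ zs u (⊆-remove sub x∉xs ys↭) zs≤xs)) (↭-sym ys↭)
      where
      zs≤xs : length zs ≤ length xs
      zs≤xs = ℕP.≤-pred (subst (_≤ suc (length xs)) (↭ₚ.↭-length ys↭) len)

    select-unique : ∀ P {xs} → Unique xs → Unique (select P xs)
    select-unique P = Unique.filter⁺ (λ x → T? (P x))

    select-sound : ∀ P {xs x} → x ∈ select P xs → T (P x)
    select-sound P {xs} x∈ = proj₂ (∈-filter⁻ (λ x → T? (P x)) {xs = xs} x∈)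

    module OverUniverse (L : List A) (L-unique : Unique L) (L-complete : ∀ x → x ∈ L) where

      count-≥ : ∀ P ws → Unique ws → All (λ w → T (P w)) ws → length ws ≤ count P L
      count-≥ P ws u Pws = subst (length ws ≤_) (sym (count≡length-select P L))
        (unique-⊆-length (select P L) u
          (λ {x} x∈ws → ∈-filter⁺ (λ x → T? (P x)) (L-complete x) (All.lookup Pws x∈ws)))

      count-injection : (f : A → A) → (∀ {x y} → f x ≡ f y → x ≡ y) →
                        ∀ P Q → (∀ x → T (P x) → T (Q (f x))) → count P L ≤ count Q L
      count-injection f f-inj P Q P⇒Qf =
        subst (_≤ count Q L) (sym (count≡length-select P L))
          (ℕP.≤-trans (ℕP.≤-reflexive (sym (ListP.length-map f (select P L))))
            (count-≥ Q (map f (select P L)) (Unique.map⁺ f-inj (select-unique P L-unique))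
              (All.tabulate image-in-Q)))
        where
        image-in-Q : ∀ {y} → y ∈ map f (select P L) → T (Q y)
        image-in-Q y∈ with ∈-map⁻ f y∈
        ... | x , x∈ , refl = P⇒Qf x (select-sound P {L} x∈)

      count-bijection : (f g : A → A) → (∀ x → g (f x) ≡ x) → (∀ x → f (g x) ≡ x) →
                        ∀ P Q → (∀ x → T (P x) → T (Q (f x))) → (∀ x → T (Q x) → T (P (g x))) →
                        count P L ≡ count Q L
      count-bijection f g gf fg P Q P⇒Qf Q⇒Pg = ℕP.≤-antisym
        (count-injection f (λ {x} {y} e → trans (sym (gf x)) (trans (cong g e) (gf y))) P Q P⇒Qf)
        (count-injection g (λ {x} {y} e → trans (sym (fg x)) (trans (cong f e) (fg y))) Q P Q⇒Pg)

    sum-if : ∀ P K xs → sum (map (λ x → if P x then K else 0) xs) ≡ count P xs * K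
    sum-if P K [] = refl
    sum-if P K (x ∷ xs) with P x
    ... | true  = cong (K +_) (sum-if P K xs)
    ... | false = sum-if P K xs

    sum-if-∧ : ∀ b P K xs → sum (map (λ x → if b ∧ P x then K else 0) xs) ≡ (if b then count P xs * K else 0)
    sum-if-∧ true  P K xs       = sum-if P K xs
    sum-if-∧ false P K []       = refl
    sum-if-∧ false P K (x ∷ xs) = sum-if-∧ false P K xs

    sum-cong : ∀ (f g : A → ℕ) → (∀ x → f x ≡ g x) → ∀ xs → sum (map f xs) ≡ sum (map g xs)
    sum-cong f g f≡g []       = refl
    sum-cong f g f≡g (x ∷ xs) = cong₂ _+_ (f≡g x) (sum-cong f g f≡g xs)

  module _ {A B : Set} where

    count-map : ∀ P (f : B → A) xs → count P (map f xs) ≡ count (λ x → P (f x)) xs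
    count-map P f [] = refl
    count-map P f (x ∷ xs) with P (f x)
    ... | true  = cong suc (count-map P f xs)
    ... | false = count-map P f xs

    count-++ : ∀ P (xs ys : List A) → count P (xs ++ ys) ≡ count P xs + count P ys
    count-++ P []       ys = refl
    count-++ P (x ∷ xs) ys with P x
    ... | true  = cong suc (count-++ P xs ys)
    ... | false = count-++ P xs ys

    count-concatMap : ∀ P (f : B → List A) xs → count P (concatMap f xs) ≡ sum (map (λ x → count P (f x)) xs)
    count-concatMap P f []       = refl
    count-concatMap P f (x ∷ xs) =
      trans (count-++ P (f x) (concatMap f xs)) (cong (count P (f x) +_) (count-concatMap P f xs))

    concatMap-unique : ∀ (f : B → List A) (t : A → B) {xs} → Unique xs → (∀ x → Unique (f x)) →
                       (∀ x {y} → y ∈ f x → t y ≡ x) → Unique (concatMap f xs)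
    concatMap-unique f t {[]}     u uf tag = []
    concatMap-unique f t {x ∷ xs} (x∉xs ∷ u) uf tag = Unique.++⁺ (uf x) (concatMap-unique f t u uf tag) disjoint
      where
      disjoint : ∀ {v} → ¬ (v ∈ f x × v ∈ concatMap f xs)
      disjoint (v∈fx , v∈rest) with find (∈-concatMap⁻ f {xs = xs} v∈rest)
      ... | x′ , x′∈xs , v∈fx′ = All.lookup x∉xs x′∈xs (trans (sym (tag x v∈fx)) (tag x′ v∈fx′))


-- Arithmetic in ℤ/ℓℤ: reduction from ℤ is a ring homomorphism, so polynomial identities over ℤ hold in ℤ/ℓℤ.
module Residues (ℓ : ℕ) .{{ℓ≢0 : NonZero ℓ}} where
  open import Data.Nat using (ℕ; zero; suc; _∸_; _<_; _≤_; NonZero)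
  import Data.Nat as ℕ
  import Data.Nat.Properties as ℕP
  open import Data.Nat.DivMod using (_/_; _%_; _mod_; m≡m%n+[m/n]*n; m%n<n; m<n⇒m%n≡m)
  open import Data.Integer using (ℤ; +_; -[1+_]; ∣_∣; _⊖_; _+_; _*_; _-_; -_; 0ℤ; 1ℤ; _%ℕ_; _/ℕ_)
  import Data.Integer.Properties as ℤP
  open import Data.Integer.DivMod using (a≡a%ℕn+[a/ℕn]*n; n%ℕd<d)
  open import Data.Integer.Tactic.RingSolver using (solve-∀; ring)
  open import Tactic.RingSolver.Core.Expression using (Expr; Κ; Ι; _⊕_; _⊗_; _⊛_; ⊝_)
  import Tactic.RingSolver.NonReflective as NonReflective
  open import Data.Vec using (Vec; lookup)
  import Data.Vec as Vec
  import Data.Vec.Properties as VecP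
  open import Data.Vec.N-ary using (N-ary)
  open import Data.Product using (_×_; proj₁; proj₂)
  open import Data.Fin using (Fin; toℕ; fromℕ<)
  open import Data.Fin.Properties using (toℕ-injective; toℕ-fromℕ<; toℕ<n)
  open import Data.Sum using (inj₁; inj₂)
  open import Data.Empty using (⊥-elim)
  open import Relation.Binary.PropositionalEquality

  module ℤRing = NonReflective.Ops ring

  𝟘 𝟙 : ∀ {n} → Expr ℤ n
  𝟘 = Κ (+ 0)
  𝟙 = Κ (+ 1)

  F : Set
  F = Fin ℓ

  infixl 6 _+F_
  infixl 7 _*F_
  _+F_ _*F_ : F → F → F
  _+F_ = _+ₗ_ ℓ
  _*F_ = _*ₗ_ ℓ

  -F_ : F → F
  -F_ = negₗ ℓ

  infixl 6 _-F_
  _-F_ : F → F → F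
  x -F y = x +F (-F y)

  0F 1F : F
  0F = 0ₗ ℓ
  1F = 1ₗ ℓ

  toℕ-mod : ∀ n → toℕ (n mod ℓ) ≡ n % ℓ
  toℕ-mod n = toℕ-fromℕ< (m%n<n n ℓ)

  small-multiple : ∀ n t → n < ℓ → n ≡ t ℕ.* ℓ → n ≡ 0
  small-multiple n zero    n<ℓ n≡ = n≡
  small-multiple n (suc t) n<ℓ n≡ =
    ⊥-elim (ℕP.<-irrefl refl (ℕP.<-≤-trans n<ℓ (subst (ℓ ≤_) (sym n≡) (ℕP.m≤m+n ℓ (t ℕ.* ℓ)))))

  ⊖-bound : ∀ m n → m < ℓ → n < ℓ → ∣ m ⊖ n ∣ < ℓ
  ⊖-bound m n m<ℓ n<ℓ with ℕP.≤-total m n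
  ... | inj₁ m≤n = subst (_< ℓ) (sym (ℤP.∣⊖∣-≤ m≤n)) (ℕP.≤-<-trans (ℕP.m∸n≤m n m) n<ℓ)
  ... | inj₂ n≤m = subst (_< ℓ) (sym (trans (ℤP.∣m⊖n∣≡∣n⊖m∣ m n) (ℤP.∣⊖∣-≤ n≤m)))
                     (ℕP.≤-<-trans (ℕP.m∸n≤m m n) m<ℓ)

  remainder-unique : ∀ a r k → r < ℓ → a ≡ + r + k * + ℓ → a %ℕ ℓ ≡ r
  remainder-unique a r k r<ℓ a≡ = sym (ℤP.+-injective (ℤP.i-j≡0⇒i≡j (+ r) (+ r′) r-r′≡0))
    where
    r′ = a %ℕ ℓ
    q′ = a /ℕ ℓ
    shift : ∀ x y k q L → x + k * L - (y + q * L) + (q - k) * L ≡ x - y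
    shift = solve-∀
    r-r′≡multiple : + r - + r′ ≡ (q′ - k) * + ℓ
    r-r′≡multiple = begin
      + r - + r′                                            ≡⟨ sym (shift (+ r) (+ r′) k q′ (+ ℓ)) ⟩
      (+ r + k * + ℓ) - (+ r′ + q′ * + ℓ) + (q′ - k) * + ℓ ≡⟨ cong₂ (λ u v → u - v + (q′ - k) * + ℓ)
                                                                  (sym a≡) (sym (a≡a%ℕn+[a/ℕn]*n a ℓ)) ⟩
      a - a + (q′ - k) * + ℓ                                ≡⟨ cong (_+ (q′ - k) * + ℓ) (ℤP.+-inverseʳ a) ⟩
      0ℤ + (q′ - k) * + ℓ                                   ≡⟨ ℤP.+-identityˡ _ ⟩
      (q′ - k) * + ℓ                                        ∎
      where open ≡-Reasoning
    distance : ∣ r ⊖ r′ ∣ ≡ ∣ q′ - k ∣ ℕ.* ℓ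
    distance = trans (cong ∣_∣ (sym (ℤP.m-n≡m⊖n r r′)))
                 (trans (cong ∣_∣ r-r′≡multiple) (ℤP.abs-* (q′ - k) (+ ℓ)))
    r-r′≡0 : + r - + r′ ≡ 0ℤ
    r-r′≡0 = trans (ℤP.m-n≡m⊖n r r′)
               (ℤP.∣i∣≡0⇒i≡0 (small-multiple ∣ r ⊖ r′ ∣ ∣ q′ - k ∣ (⊖-bound r r′ r<ℓ (n%ℕd<d a ℓ)) distance))

  remainder-unique′ : ∀ a n k → a ≡ + n + k * + ℓ → a %ℕ ℓ ≡ n % ℓ
  remainder-unique′ a n k a≡ = remainder-unique a (n % ℓ) (+ (n / ℓ) + k) (m%n<n n ℓ) (begin
      a                                      ≡⟨ a≡ ⟩
      + n + k * + ℓ                          ≡⟨ cong (_+ k * + ℓ) n≡ ⟩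
      + (n % ℓ) + + (n / ℓ) * + ℓ + k * + ℓ ≡⟨ regroup (+ (n % ℓ)) (+ (n / ℓ)) k (+ ℓ) ⟩
      + (n % ℓ) + (+ (n / ℓ) + k) * + ℓ     ∎)
    where
    open ≡-Reasoning
    regroup : ∀ x p k L → x + p * L + k * L ≡ x + (p + k) * L
    regroup = solve-∀
    n≡ : + n ≡ + (n % ℓ) + + (n / ℓ) * + ℓ
    n≡ = trans (cong +_ (m≡m%n+[m/n]*n n ℓ))
               (trans (ℤP.pos-+ (n % ℓ) _) (cong (λ w → + (n % ℓ) + w) (ℤP.pos-* (n / ℓ) ℓ)))

  reduce : ℤ → F
  reduce a = fromℕ< (n%ℕd<d a ℓ)

  toℕ-reduce : ∀ a → toℕ (reduce a) ≡ a %ℕ ℓ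
  toℕ-reduce a = toℕ-fromℕ< (n%ℕd<d a ℓ)

  private
    split : ∀ a → a ≡ + (a %ℕ ℓ) + (a /ℕ ℓ) * + ℓ
    split a = a≡a%ℕn+[a/ℕn]*n a ℓ

    reduce-by : ∀ a n k → a ≡ + n + k * + ℓ → toℕ (reduce a) ≡ n % ℓ
    reduce-by a n k a≡ = trans (toℕ-reduce a) (remainder-unique′ a n k a≡)

  reduce-+ : ∀ a b → reduce (a + b) ≡ reduce a +F reduce b
  reduce-+ a b = toℕ-injective (trans (reduce-by (a + b) (ra ℕ.+ rb) (qa + qb) a+b≡)
      (sym (trans (toℕ-mod _) (cong₂ (λ u v → (u ℕ.+ v) % ℓ) (toℕ-reduce a) (toℕ-reduce b)))))
    where
    ra = a %ℕ ℓ ; rb = b %ℕ ℓ ; qa = a /ℕ ℓ ; qb = b /ℕ ℓ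
    regroup : ∀ x y p q L → (x + p * L) + (y + q * L) ≡ (x + y) + (p + q) * L
    regroup = solve-∀
    a+b≡ : a + b ≡ + (ra ℕ.+ rb) + (qa + qb) * + ℓ
    a+b≡ = trans (cong₂ _+_ (split a) (split b))
             (trans (regroup (+ ra) (+ rb) qa qb (+ ℓ)) (cong (_+ (qa + qb) * + ℓ) (sym (ℤP.pos-+ ra rb))))

  reduce-* : ∀ a b → reduce (a * b) ≡ reduce a *F reduce b
  reduce-* a b = toℕ-injective (trans (reduce-by (a * b) (ra ℕ.* rb) k ab≡)
      (sym (trans (toℕ-mod _) (cong₂ (λ u v → (u ℕ.* v) % ℓ) (toℕ-reduce a) (toℕ-reduce b)))))
    where
    ra = a %ℕ ℓ ; rb = b %ℕ ℓ ; qa = a /ℕ ℓ ; qb = b /ℕ ℓ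
    k = + ra * qb + qa * + rb + qa * qb * + ℓ
    expand : ∀ x y p q L → (x + p * L) * (y + q * L) ≡ (x * y) + (x * q + p * y + p * q * L) * L
    expand = solve-∀
    ab≡ : a * b ≡ + (ra ℕ.* rb) + k * + ℓ
    ab≡ = trans (cong₂ _*_ (split a) (split b))
            (trans (expand (+ ra) (+ rb) qa qb (+ ℓ)) (cong (_+ k * + ℓ) (sym (ℤP.pos-* ra rb))))

  reduce-neg : ∀ a → reduce (- a) ≡ -F reduce a
  reduce-neg a = toℕ-injective (trans (reduce-by (- a) (ℓ ∸ ra) (- qa - 1ℤ) -a≡)
      (sym (trans (toℕ-mod _) (cong (λ u → (ℓ ∸ u) % ℓ) (toℕ-reduce a)))))
    where
    ra = a %ℕ ℓ ; qa = a /ℕ ℓ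
    negate : ∀ x p L → - (x + p * L) ≡ (L - x) + (- p - 1ℤ) * L
    negate = solve-∀
    -a≡ : - a ≡ + (ℓ ∸ ra) + (- qa - 1ℤ) * + ℓ
    -a≡ = trans (cong -_ (split a)) (trans (negate (+ ra) qa (+ ℓ))
            (cong (_+ (- qa - 1ℤ) * + ℓ) (trans (ℤP.m-n≡m⊖n ℓ ra) (ℤP.⊖-≥ (ℕP.<⇒≤ (n%ℕd<d a ℓ))))))

  reduce-lift : ∀ x → reduce (+ toℕ x) ≡ x
  reduce-lift x = toℕ-injective (trans (toℕ-reduce (+ toℕ x)) (m<n⇒m%n≡m (toℕ<n x)))

  constant : ℤ → F
  constant (+ n)    = n mod ℓ
  constant -[1+ n ] = -F (suc n mod ℓ)

  constant≡reduce : ∀ c → constant c ≡ reduce c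
  constant≡reduce (+ n)    = toℕ-injective (trans (toℕ-mod n) (sym (toℕ-reduce (+ n))))
  constant≡reduce -[1+ n ] = sym (trans (reduce-neg (+ suc n)) (cong -F_ (sym (constant≡reduce (+ suc n)))))

  -- Powers with the same recursion as the ring solver's exponentiation.
  power : ℕ → F → F
  power 0             x = 1F
  power 1             x = x
  power (suc (suc n)) x = power (suc n) x *F x

  ⟦_⟧F : ∀ {n} → Expr ℤ n → Vec F n → F
  ⟦ Κ c   ⟧F ρ = constant c
  ⟦ Ι i   ⟧F ρ = lookup ρ i
  ⟦ x ⊕ y ⟧F ρ = ⟦ x ⟧F ρ +F ⟦ y ⟧F ρ
  ⟦ x ⊗ y ⟧F ρ = ⟦ x ⟧F ρ *F ⟦ y ⟧F ρ
  ⟦ x ⊛ i ⟧F ρ = power i (⟦ x ⟧F ρ)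
  ⟦ ⊝ x   ⟧F ρ = -F ⟦ x ⟧F ρ

  ⟦⟧-reduce : ∀ {n} (e : Expr ℤ n) ρ → ⟦ e ⟧F (Vec.map reduce ρ) ≡ reduce (ℤRing.⟦ e ⟧ ρ)
  ⟦⟧-reduce (Κ c)   ρ = constant≡reduce c
  ⟦⟧-reduce (Ι i)   ρ = VecP.lookup-map i reduce ρ
  ⟦⟧-reduce (x ⊕ y) ρ = trans (cong₂ _+F_ (⟦⟧-reduce x ρ) (⟦⟧-reduce y ρ)) (sym (reduce-+ (ℤRing.⟦ x ⟧ ρ) (ℤRing.⟦ y ⟧ ρ)))
  ⟦⟧-reduce (x ⊗ y) ρ = trans (cong₂ _*F_ (⟦⟧-reduce x ρ) (⟦⟧-reduce y ρ)) (sym (reduce-* (ℤRing.⟦ x ⟧ ρ) (ℤRing.⟦ y ⟧ ρ)))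
  ⟦⟧-reduce (⊝ x)   ρ = trans (cong -F_ (⟦⟧-reduce x ρ)) (sym (reduce-neg (ℤRing.⟦ x ⟧ ρ)))
  ⟦⟧-reduce (x ⊛ 0) ρ = constant≡reduce (+ 1)
  ⟦⟧-reduce (x ⊛ 1) ρ = ⟦⟧-reduce x ρ
  ⟦⟧-reduce (x ⊛ suc (suc i)) ρ =
    trans (cong₂ _*F_ (⟦⟧-reduce (x ⊛ suc i) ρ) (⟦⟧-reduce x ρ))
          (sym (reduce-* (ℤRing.⟦ x ⊛ suc i ⟧ ρ) (ℤRing.⟦ x ⟧ ρ)))

  -- Every polynomial identity over ℤ holds in ℤ/ℓℤ, because reduction is a
  -- surjective ring homomorphism.  The hypothesis (that both sides have the
  -- same normal form) is discharged by refl; this is how ring identities in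
  -- ℤ/ℓℤ are proved below.
  polynomial-identity : ∀ n (f : N-ary n (Expr ℤ n) (Expr ℤ n × Expr ℤ n)) →
    (∀ ρ → ℤRing.⟦ proj₁ (ℤRing.close n f) ⇓⟧ ρ ≡ ℤRing.⟦ proj₂ (ℤRing.close n f) ⇓⟧ ρ) →
    (σ : Vec F n) → ⟦ proj₁ (ℤRing.close n f) ⟧F σ ≡ ⟦ proj₂ (ℤRing.close n f) ⟧F σ
  polynomial-identity n f same-normal-form σ = begin
      ⟦ lhs ⟧F σ                     ≡⟨ cong ⟦ lhs ⟧F σ≡ ⟩
      ⟦ lhs ⟧F (Vec.map reduce ρ)   ≡⟨ ⟦⟧-reduce lhs ρ ⟩
      reduce (ℤRing.⟦ lhs ⟧ ρ)      ≡⟨ cong reduce (ℤRing.prove ρ lhs rhs (same-normal-form ρ)) ⟩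
      reduce (ℤRing.⟦ rhs ⟧ ρ)      ≡⟨ sym (⟦⟧-reduce rhs ρ) ⟩
      ⟦ rhs ⟧F (Vec.map reduce ρ)   ≡⟨ cong ⟦ rhs ⟧F (sym σ≡) ⟩
      ⟦ rhs ⟧F σ                     ∎
    where
    open ≡-Reasoning
    lhs = proj₁ (ℤRing.close n f)
    rhs = proj₂ (ℤRing.close n f)
    ρ = Vec.map (λ x → + toℕ x) σ
    σ≡ : σ ≡ Vec.map reduce ρ
    σ≡ = sym (trans (sym (VecP.map-∘ reduce (λ x → + toℕ x) σ))
                    (trans (VecP.map-cong reduce-lift σ) (VecP.map-id σ)))


module PrimeField (ℓ : ℕ) .{{ℓ≢0 : NonZero ℓ}} (ℓ-prime : Prime ℓ) where
  open Counting
  open import Data.Nat using (ℕ; zero; suc; _+_; _*_; _∸_; _<_; _≤_; z≤n; s≤s; NonZero; nonTrivial⇒n>1)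
  import Data.Nat.Properties as ℕP
  open import Data.Nat.DivMod using (m<n⇒m%n≡m)
  open import Data.Nat.Divisibility using (_∣_; m%n≡0⇒n∣m; ∣⇒≤)
  open import Data.Nat.Primality using (Prime; prime⇒nonTrivial; euclidsLemma)
  open import Tactic.RingSolver.Core.Expression using (_⊕_; _⊗_; ⊝_)
  open import Data.Fin using (toℕ)
  open import Data.Fin.Properties using (toℕ-injective; toℕ<n) renaming (_≟_ to _≟F_)
  open import Data.Vec using ([]; _∷_)
  open import Data.Bool using (Bool; true; not; T)
  open import Data.List using (List; []; _∷_; length; map; allFin)
  import Data.List.Properties as ListP
  open import Data.List.Membership.Propositional using (_∈_)
  open import Data.List.Membership.Propositional.Properties using (∈-allFin; ∈-map⁻; ∈-filter⁺)
  open import Data.List.Relation.Unary.Any using (here)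
  open import Data.List.Relation.Unary.All using (All; []; _∷_)
  import Data.List.Relation.Unary.All as All
  open import Data.List.Relation.Unary.Unique.Propositional using (Unique)
  open import Data.List.Relation.Binary.Permutation.Propositional as ↭ using (_↭_)
  import Data.List.Relation.Unary.Unique.Propositional.Properties as Unique
  open import Data.Bool.Properties using (T?)
  open import Data.Product using (_,_)
  open import Data.Sum using (_⊎_; inj₁; inj₂; [_,_]′)
  open import Data.Empty using (⊥-elim)
  open import Data.Unit using (tt)
  open import Relation.Binary.PropositionalEquality
  open import Relation.Nullary using (yes; no)
  open import Relation.Nullary.Decidable using (toWitness; fromWitness)

  open Residues ℓ public

  1<ℓ : 1 < ℓ
  1<ℓ = nonTrivial⇒n>1 ℓ {{prime⇒nonTrivial ℓ-prime}}

  toℕ-0F : toℕ 0F ≡ 0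
  toℕ-0F = trans (toℕ-mod 0) (m<n⇒m%n≡m (ℕP.<-trans (s≤s z≤n) 1<ℓ))

  1F≢0F : 1F ≢ 0F
  1F≢0F e = ℕP.1+n≢0 (trans (sym (trans (toℕ-mod 1) (m<n⇒m%n≡m 1<ℓ))) (trans (cong toℕ e) toℕ-0F))

  multiple-of-ℓ : ∀ z → ℓ ∣ toℕ z → z ≡ 0F
  multiple-of-ℓ z ℓ∣z = toℕ-injective (trans (below-ℓ (toℕ z) (toℕ<n z) ℓ∣z) (sym toℕ-0F))
    where
    below-ℓ : ∀ t → t < ℓ → ℓ ∣ t → t ≡ 0
    below-ℓ zero    _   _   = refl
    below-ℓ (suc t) t<ℓ ℓ∣t = ⊥-elim (ℕP.<-irrefl refl (ℕP.<-≤-trans t<ℓ (∣⇒≤ ℓ∣t)))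

  zero-product : ∀ x y → x *F y ≡ 0F → x ≡ 0F ⊎ y ≡ 0F
  zero-product x y xy≡0 with euclidsLemma (toℕ x) (toℕ y) ℓ-prime
                               (m%n≡0⇒n∣m _ ℓ (trans (sym (toℕ-mod _)) (trans (cong toℕ xy≡0) toℕ-0F)))
  ... | inj₁ ℓ∣x = inj₁ (multiple-of-ℓ x ℓ∣x)
  ... | inj₂ ℓ∣y = inj₂ (multiple-of-ℓ y ℓ∣y)

  *-nonzero : ∀ {x y} → x ≢ 0F → y ≢ 0F → x *F y ≢ 0F
  *-nonzero x≢0 y≢0 xy≡0 = [ x≢0 , y≢0 ]′ (zero-product _ _ xy≡0)

  difference-zero : ∀ x y → x -F y ≡ 0F → x ≡ y
  difference-zero x y x-y≡0 = begin
      x                  ≡⟨ polynomial-identity 2 (λ x y → x , (x ⊕ (⊝ y)) ⊕ y) (λ _ → refl) (x ∷ y ∷ []) ⟩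
      (x -F y) +F y      ≡⟨ cong (_+F y) x-y≡0 ⟩
      0F +F y            ≡⟨ polynomial-identity 1 (λ y → (𝟘 ⊕ y) , y) (λ _ → refl) (y ∷ []) ⟩
      y                  ∎
    where open ≡-Reasoning

  *-cancelˡ : ∀ x → x ≢ 0F → ∀ {a b} → x *F a ≡ x *F b → a ≡ b
  *-cancelˡ x x≢0 {a} {b} xa≡xb = [ (λ x≡0 → ⊥-elim (x≢0 x≡0)) , difference-zero a b ]′
    (zero-product x (a -F b) (begin
      x *F (a -F b)              ≡⟨ polynomial-identity 3 (λ x a b → (x ⊗ (a ⊕ (⊝ b))) , (x ⊗ a ⊕ (⊝ (x ⊗ b))))
                                      (λ _ → refl) (x ∷ a ∷ b ∷ []) ⟩
      x *F a -F x *F b           ≡⟨ cong (_-F x *F b) xa≡xb ⟩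
      x *F b -F x *F b           ≡⟨ polynomial-identity 1 (λ u → (u ⊕ (⊝ u)) , 𝟘) (λ _ → refl) (x *F b ∷ []) ⟩
      0F                         ∎))
    where open ≡-Reasoning

  infix 4 _==F_
  _==F_ : F → F → Bool
  x ==F y = _==_ ℓ x y

  ==F-sound : ∀ {x y} → T (x ==F y) → x ≡ y
  ==F-sound = toWitness

  ==F-complete : ∀ {x y} → x ≡ y → T (x ==F y)
  ==F-complete = fromWitness

  ≠F-sound : ∀ {x y} → T (not (x ==F y)) → x ≢ y
  ≠F-sound {x} {y} t with x ≟F y
  ... | no x≢y = x≢y

  ≠F-complete : ∀ {x y} → x ≢ y → T (not (x ==F y))
  ≠F-complete {x} {y} x≢y with x ≟F y
  ... | yes x≡y = x≢y x≡y
  ... | no  _   = tt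

  nonzero : F → Bool
  nonzero x = not (x ==F 0F)

  countF : (F → Bool) → ℕ
  countF P = count P (allFin ℓ)

  open OverUniverse (allFin ℓ) (Unique.allFin⁺ ℓ) ∈-allFin
    renaming (count-≥ to countF-≥)

  count-singleton : ∀ a → countF (_==F a) ≡ 1
  count-singleton a = ℕP.≤-antisym at-most-one (count-pos (_==F a) (∈-allFin a) (==F-complete refl))
    where
    at-most-one : countF (_==F a) ≤ 1
    at-most-one = subst (_≤ 1) (sym (count≡length-select (_==F a) (allFin ℓ)))
      (unique-⊆-length (a ∷ []) (select-unique (_==F a) (Unique.allFin⁺ ℓ))
        (λ x∈ → here (==F-sound (select-sound (_==F a) {allFin ℓ} x∈))))

  count-nonzero : countF nonzero ≡ ℓ ∸ 1
  count-nonzero = begin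
      countF nonzero                                     ≡⟨ sym (ℕP.m+n∸m≡n 1 (countF nonzero)) ⟩
      1 + countF nonzero ∸ 1                             ≡⟨ cong (λ w → w + countF nonzero ∸ 1) (sym (count-singleton 0F)) ⟩
      countF (_==F 0F) + countF nonzero ∸ 1              ≡⟨ cong (_∸ 1) (sym (count-split (λ _ → true) (_==F 0F) (allFin ℓ))) ⟩
      countF (λ _ → true) ∸ 1                            ≡⟨ cong (_∸ 1) (trans (count-true (allFin ℓ)) (ListP.length-tabulate {n = ℓ} (λ i → i))) ⟩
      ℓ ∸ 1                                              ∎
    where open ≡-Reasoning

  infixr 8 _^F_
  _^F_ : F → ℕ → F
  x ^F zero  = 1F
  x ^F suc n = x *F x ^F n

  ^F-+ : ∀ x m n → x ^F (m + n) ≡ x ^F m *F x ^F n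
  ^F-+ x zero    n = polynomial-identity 1 (λ a → a , (𝟙 ⊗ a)) (λ _ → refl) (x ^F n ∷ [])
  ^F-+ x (suc m) n = trans (cong (x *F_) (^F-+ x m n))
    (polynomial-identity 3 (λ a b c → (a ⊗ (b ⊗ c)) , ((a ⊗ b) ⊗ c)) (λ _ → refl) (x ∷ x ^F m ∷ x ^F n ∷ []))

  1^F : ∀ n → 1F ^F n ≡ 1F
  1^F zero    = refl
  1^F (suc n) = trans (cong (1F *F_) (1^F n)) (polynomial-identity 0 (𝟙 ⊗ 𝟙 , 𝟙) (λ _ → refl) [])

  *-^F : ∀ x y n → (x *F y) ^F n ≡ x ^F n *F y ^F n
  *-^F x y zero    = polynomial-identity 0 (𝟙 , 𝟙 ⊗ 𝟙) (λ _ → refl) []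
  *-^F x y (suc n) = trans (cong ((x *F y) *F_) (*-^F x y n))
    (polynomial-identity 4 (λ a b c d → ((a ⊗ b) ⊗ (c ⊗ d)) , ((a ⊗ c) ⊗ (b ⊗ d))) (λ _ → refl)
      (x ∷ y ∷ x ^F n ∷ y ^F n ∷ []))

  ^F-* : ∀ x m n → x ^F (m * n) ≡ (x ^F m) ^F n
  ^F-* x zero    n = sym (1^F n)
  ^F-* x (suc m) n = trans (^F-+ x n (m * n)) (trans (cong (x ^F n *F_) (^F-* x m n)) (sym (*-^F x (x ^F m) n)))

  productF : List F → F
  productF []       = 1F
  productF (x ∷ xs) = x *F productF xs

  productF-↭ : ∀ {xs ys} → xs ↭ ys → productF xs ≡ productF ys
  productF-↭ ↭.refl           = refl
  productF-↭ (↭.prep x p)     = cong (x *F_) (productF-↭ p)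
  productF-↭ (↭.swap x y p)   = trans (cong (λ w → x *F (y *F w)) (productF-↭ p))
    (polynomial-identity 3 (λ x y z → (x ⊗ (y ⊗ z)) , (y ⊗ (x ⊗ z))) (λ _ → refl) (x ∷ y ∷ _ ∷ []))
  productF-↭ (↭.trans p q)    = trans (productF-↭ p) (productF-↭ q)

  productF-scale : ∀ x xs → productF (map (x *F_) xs) ≡ x ^F length xs *F productF xs
  productF-scale x []       = polynomial-identity 0 (𝟙 , 𝟙 ⊗ 𝟙) (λ _ → refl) []
  productF-scale x (a ∷ xs) = trans (cong ((x *F a) *F_) (productF-scale x xs))
    (polynomial-identity 4 (λ x a p P → ((x ⊗ a) ⊗ (p ⊗ P)) , ((x ⊗ p) ⊗ (a ⊗ P))) (λ _ → refl)
      (x ∷ a ∷ x ^F length xs ∷ productF xs ∷ []))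

  productF-nonzero : ∀ xs → All (_≢ 0F) xs → productF xs ≢ 0F
  productF-nonzero []       []             = 1F≢0F
  productF-nonzero (a ∷ xs) (a≢0 ∷ xs≢0) = *-nonzero a≢0 (productF-nonzero xs xs≢0)

  -- Fermat's little theorem: multiplication by x ≠ 0 permutes the nonzero
  -- residues, so x^(ℓ-1) times their (nonzero) product equals that product.
  fermat : ∀ x → x ≢ 0F → x ^F (ℓ ∸ 1) ≡ 1F
  fermat x x≢0 = *-cancelˡ P P≢0 (begin
      P *F x ^F (ℓ ∸ 1)            ≡⟨ polynomial-identity 2 (λ P y → (P ⊗ y) , (y ⊗ P)) (λ _ → refl) (P ∷ x ^F (ℓ ∸ 1) ∷ []) ⟩
      x ^F (ℓ ∸ 1) *F P            ≡⟨ cong (λ n → x ^F n *F P) (sym length-units) ⟩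
      x ^F length units *F P       ≡⟨ sym (productF-scale x units) ⟩
      productF (map (x *F_) units) ≡⟨ productF-↭ scaled↭units ⟩
      P                            ≡⟨ polynomial-identity 1 (λ P → P , (P ⊗ 𝟙)) (λ _ → refl) (P ∷ []) ⟩
      P *F 1F                      ∎)
    where
    open ≡-Reasoning
    units = select nonzero (allFin ℓ)
    P = productF units
    length-units : length units ≡ ℓ ∸ 1
    length-units = trans (sym (count≡length-select nonzero (allFin ℓ))) count-nonzero
    unit-nonzero : ∀ {a} → a ∈ units → a ≢ 0F
    unit-nonzero a∈ = ≠F-sound (select-sound nonzero {allFin ℓ} a∈)
    P≢0 : P ≢ 0F
    P≢0 = productF-nonzero units (All.tabulate unit-nonzero)
    scaled⊆units : ∀ {y} → y ∈ map (x *F_) units → y ∈ units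
    scaled⊆units y∈ with ∈-map⁻ (x *F_) y∈
    ... | a , a∈ , refl = ∈-filter⁺ (λ z → T? (nonzero z)) (∈-allFin (x *F a))
                            (≠F-complete (*-nonzero x≢0 (unit-nonzero a∈)))
    scaled↭units : map (x *F_) units ↭ units
    scaled↭units = unique-⊆-↭ units (Unique.map⁺ (*-cancelˡ x x≢0) (select-unique nonzero (Unique.allFin⁺ ℓ)))
                     scaled⊆units (ℕP.≤-reflexive (sym (ListP.length-map (x *F_) units)))

  inverse : F → F
  inverse x = x ^F (ℓ ∸ 2)

  -- x · x^(ℓ-2) = x^(ℓ-1) = 1 by Fermat.
  inverseʳ : ∀ x → x ≢ 0F → x *F inverse x ≡ 1F
  inverseʳ x x≢0 = trans (cong (x ^F_) (suc[ℓ∸2] ℓ 1<ℓ)) (fermat x x≢0)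
    where
    suc[ℓ∸2] : ∀ n → 1 < n → suc (n ∸ 2) ≡ n ∸ 1
    suc[ℓ∸2] (suc zero)    (s≤s ())
    suc[ℓ∸2] (suc (suc n)) _        = refl

  inverseˡ : ∀ x → x ≢ 0F → inverse x *F x ≡ 1F
  inverseˡ x x≢0 = trans (polynomial-identity 2 (λ a b → (a ⊗ b) , (b ⊗ a)) (λ _ → refl) (inverse x ∷ x ∷ []))
                         (inverseʳ x x≢0)


module RootsOfUnity (ℓ : ℕ) .{{ℓ≢0 : NonZero ℓ}} (ℓ-prime : Prime ℓ) where
  open Counting
  open import Data.Nat using (ℕ; zero; suc; _+_; _*_; _∸_; _<_; _≤_; z≤n; s≤s; NonZero)
  import Data.Nat.Properties as ℕP
  open import Data.Nat.Divisibility using (_∣_; divides; 0∣⇒≡0)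
  open import Data.Nat.Primality using (Prime)
  open import Tactic.RingSolver.Core.Expression using (_⊕_; _⊗_; ⊝_)
  open import Data.Vec using ([]; _∷_)
  open import Data.Bool using (Bool; _∧_; _∨_; not; T)
  open import Data.Bool.Properties using (T-∨; T-∧)
  open import Data.List using (List; []; _∷_; length; replicate; _++_; allFin)
  import Data.List.Properties as ListP
  open import Data.List.Relation.Unary.All using (All; []; _∷_)
  open import Data.List.Relation.Unary.AllPairs using (_∷_)
  import Data.List.Relation.Unary.All as All
  open import Data.List.Relation.Unary.Unique.Propositional using (Unique)
  import Data.List.Relation.Unary.Unique.Propositional.Properties as Unique
  open import Data.Product using (_×_; _,_; ∃; proj₁; proj₂)
  open import Data.Sum using ([_,_]′)
  import Data.Sum
  open import Data.Empty using (⊥-elim)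
  open import Function.Bundles using (Equivalence)
  open import Relation.Binary.PropositionalEquality

  open PrimeField ℓ ℓ-prime

  ℓ∸1>0 : 0 < ℓ ∸ 1
  ℓ∸1>0 = ℕP.m<n⇒0<n∸m 1<ℓ

  divisor-positive : ∀ {k} → k ∣ ℓ ∸ 1 → 0 < k
  divisor-positive k∣ = ℕP.n≢0⇒n>0 (λ { refl → ℕP.<⇒≢ ℓ∸1>0 (sym (0∣⇒≡0 k∣)) })

  -- A monic polynomial c₀ + c₁x + ⋯ + c_{d-1}x^{d-1} + x^d is represented by the
  -- list [c₀, …, c_{d-1}] of its lower coefficients, so its degree is the length.
  Monic : Set
  Monic = List F

  eval : Monic → F → F
  eval []       x = 1F
  eval (c ∷ cs) x = c +F x *F eval cs x

  -- Synthetic division by x - a: eval p x = (x - a) · eval (quotient a p) x + eval p a.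
  quotient : F → Monic → Monic
  quotient a []            = []
  quotient a (c ∷ [])      = []
  quotient a (c ∷ c′ ∷ cs) = eval (c′ ∷ cs) a ∷ quotient a (c′ ∷ cs)

  quotient-length : ∀ a c cs → length (quotient a (c ∷ cs)) ≡ length cs
  quotient-length a c []        = refl
  quotient-length a c (c′ ∷ cs) = cong suc (quotient-length a c′ cs)

  division : ∀ a c cs x → eval (c ∷ cs) x ≡ (x -F a) *F eval (quotient a (c ∷ cs)) x +F eval (c ∷ cs) a
  division a c []        x = polynomial-identity 3 (λ a c x → (c ⊕ x ⊗ 𝟙) , ((x ⊕ (⊝ a)) ⊗ 𝟙 ⊕ (c ⊕ a ⊗ 𝟙)))
                               (λ _ → refl) (a ∷ c ∷ x ∷ [])
  division a c (c′ ∷ cs) x = begin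
      c +F x *F eval (c′ ∷ cs) x      ≡⟨ cong (λ w → c +F x *F w) (division a c′ cs x) ⟩
      c +F x *F ((x -F a) *F Q +F r)  ≡⟨ polynomial-identity 5
                                           (λ a c x Q r → (c ⊕ x ⊗ ((x ⊕ (⊝ a)) ⊗ Q ⊕ r)) ,
                                                          ((x ⊕ (⊝ a)) ⊗ (r ⊕ x ⊗ Q) ⊕ (c ⊕ a ⊗ r)))
                                           (λ _ → refl) (a ∷ c ∷ x ∷ Q ∷ r ∷ []) ⟩
      (x -F a) *F (r +F x *F Q) +F (c +F a *F r) ∎
    where
    open ≡-Reasoning
    Q = eval (quotient a (c′ ∷ cs)) x
    r = eval (c′ ∷ cs) a

  -- A monic polynomial of degree d has at most d distinct roots: dividing by
  -- x - r for a root r leaves a polynomial vanishing at all the other roots.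
  root-bound : ∀ p rs → Unique rs → All (λ r → eval p r ≡ 0F) rs → length rs ≤ length p
  root-bound p        []       _            _              = z≤n
  root-bound []       (r ∷ rs) _            (1≡0 ∷ _)      = ⊥-elim (1F≢0F 1≡0)
  root-bound (c ∷ cs) (r ∷ rs) (r∉rs ∷ u) (pr≡0 ∷ prs≡0) =
    s≤s (subst (length rs ≤_) (quotient-length r c cs)
          (root-bound (quotient r (c ∷ cs)) rs u (All.zipWith root-of-quotient (r∉rs , prs≡0))))
    where
    root-of-quotient : ∀ {s} → r ≢ s × eval (c ∷ cs) s ≡ 0F → eval (quotient r (c ∷ cs)) s ≡ 0F
    root-of-quotient {s} (r≢s , ps≡0) =
      [ (λ s-r≡0 → ⊥-elim (r≢s (sym (difference-zero s r s-r≡0)))) , (λ q≡0 → q≡0) ]′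
        (zero-product (s -F r) _ (begin
          (s -F r) *F eval (quotient r (c ∷ cs)) s         ≡⟨ polynomial-identity 1 (λ u → u , (u ⊕ 𝟘)) (λ _ → refl) (_ ∷ []) ⟩
          (s -F r) *F eval (quotient r (c ∷ cs)) s +F 0F   ≡⟨ cong ((s -F r) *F eval (quotient r (c ∷ cs)) s +F_) (sym pr≡0) ⟩
          (s -F r) *F eval (quotient r (c ∷ cs)) s +F eval (c ∷ cs) r ≡⟨ sym (division r c cs s) ⟩
          eval (c ∷ cs) s                                   ≡⟨ ps≡0 ⟩
          0F                                                ∎))
      where open ≡-Reasoning

  count-roots : ∀ p → countF (λ x → eval p x ==F 0F) ≤ length p
  count-roots p = subst (_≤ length p) (sym (count≡length-select _ (allFin ℓ)))
    (root-bound p _ (select-unique _ (Unique.allFin⁺ ℓ))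
      (All.tabulate (λ x∈ → ==F-sound (select-sound (λ x → eval p x ==F 0F) {allFin ℓ} x∈))))

  eval-shift : ∀ t p x → eval (replicate t 0F ++ p) x ≡ x ^F t *F eval p x
  eval-shift zero    p x = polynomial-identity 1 (λ a → a , (𝟙 ⊗ a)) (λ _ → refl) (eval p x ∷ [])
  eval-shift (suc t) p x = trans (cong (λ w → 0F +F x *F w) (eval-shift t p x))
    (polynomial-identity 3 (λ x p e → (𝟘 ⊕ x ⊗ (p ⊗ e)) , ((x ⊗ p) ⊗ e)) (λ _ → refl) (x ∷ x ^F t ∷ eval p x ∷ []))

  unity-polynomial : ℕ → Monic
  unity-polynomial k′ = (-F 1F) ∷ replicate k′ 0F

  eval-unity-polynomial : ∀ k′ x → eval (unity-polynomial k′) x ≡ x ^F suc k′ -F 1F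
  eval-unity-polynomial k′ x = begin
      -F 1F +F x *F eval (replicate k′ 0F) x    ≡⟨ cong (λ l → -F 1F +F x *F eval l x) (sym (ListP.++-identityʳ (replicate k′ 0F))) ⟩
      -F 1F +F x *F eval (replicate k′ 0F ++ []) x ≡⟨ cong (λ w → -F 1F +F x *F w) (eval-shift k′ [] x) ⟩
      -F 1F +F x *F (x ^F k′ *F 1F)             ≡⟨ polynomial-identity 2 (λ x p → ((⊝ 𝟙) ⊕ x ⊗ (p ⊗ 𝟙)) , (x ⊗ p ⊕ (⊝ 𝟙)))
                                                     (λ _ → refl) (x ∷ x ^F k′ ∷ []) ⟩
      x ^F suc k′ -F 1F                         ∎
    where open ≡-Reasoning

  -- The geometric sum 1 + y + ⋯ + y^j in y = x^(k′+1), a monic polynomial of degree j(k′+1).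
  geometric : ℕ → ℕ → Monic
  geometric k′ zero    = []
  geometric k′ (suc j) = 1F ∷ (replicate k′ 0F ++ geometric k′ j)

  geometric-length : ∀ k′ j → length (geometric k′ j) ≡ j * suc k′
  geometric-length k′ zero    = refl
  geometric-length k′ (suc j) = cong suc (trans (ListP.length-++ (replicate k′ 0F))
                                  (cong₂ _+_ (ListP.length-replicate k′) (geometric-length k′ j)))

  geometric-identity : ∀ k′ j x → (x ^F suc k′ -F 1F) *F eval (geometric k′ j) x ≡ x ^F (suc j * suc k′) -F 1F
  geometric-identity k′ zero    x = trans
    (polynomial-identity 1 (λ y → ((y ⊕ (⊝ 𝟙)) ⊗ 𝟙) , (y ⊕ (⊝ 𝟙))) (λ _ → refl) (x ^F suc k′ ∷ []))
    (cong (λ n → x ^F n -F 1F) (sym (ℕP.*-identityˡ (suc k′))))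
  geometric-identity k′ (suc j) x = begin
      (y -F 1F) *F (1F +F x *F eval (replicate k′ 0F ++ geometric k′ j) x)
        ≡⟨ cong (λ w → (y -F 1F) *F (1F +F x *F w)) (eval-shift k′ (geometric k′ j) x) ⟩
      (y -F 1F) *F (1F +F x *F (x ^F k′ *F E))
        ≡⟨ polynomial-identity 3 (λ x p E → ((x ⊗ p ⊕ (⊝ 𝟙)) ⊗ (𝟙 ⊕ x ⊗ (p ⊗ E))) ,
                                            ((x ⊗ p ⊕ (⊝ 𝟙)) ⊕ (x ⊗ p) ⊗ ((x ⊗ p ⊕ (⊝ 𝟙)) ⊗ E)))
             (λ _ → refl) (x ∷ x ^F k′ ∷ E ∷ []) ⟩
      (y -F 1F) +F y *F ((y -F 1F) *F E)
        ≡⟨ cong (λ w → (y -F 1F) +F y *F w) (geometric-identity k′ j x) ⟩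
      (y -F 1F) +F y *F (x ^F (suc j * suc k′) -F 1F)
        ≡⟨ polynomial-identity 2 (λ y Z → ((y ⊕ (⊝ 𝟙)) ⊕ y ⊗ (Z ⊕ (⊝ 𝟙))) , (y ⊗ Z ⊕ (⊝ 𝟙)))
             (λ _ → refl) (y ∷ x ^F (suc j * suc k′) ∷ []) ⟩
      y *F x ^F (suc j * suc k′) -F 1F
        ≡⟨ cong (_-F 1F) (sym (^F-+ x (suc k′) (suc j * suc k′))) ⟩
      x ^F (suc (suc j) * suc k′) -F 1F ∎
    where
    open ≡-Reasoning
    y = x ^F suc k′
    E = eval (geometric k′ j) x

  μ : ℕ → F → Bool
  μ k x = x ^F k ==F 1F

  -- If k divides ℓ - 1 then μ_k has exactly k elements: at most k as roots of
  -- x^k - 1, and at least k because the ℓ - 1 nonzero residues are roots of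
  -- x^(ℓ-1) - 1 = (x^k - 1)(1 + x^k + ⋯ + x^(ℓ-1-k)) (Fermat), while the second
  -- factor has at most ℓ - 1 - k roots.
  count-μ : ∀ k → k ∣ ℓ ∸ 1 → countF (μ k) ≡ k
  count-μ zero     k∣ = ⊥-elim (ℕP.<-irrefl refl (divisor-positive k∣))
  count-μ (suc k′) (divides zero ℓ∸1≡0) = ⊥-elim (ℕP.<⇒≢ ℓ∸1>0 (sym ℓ∸1≡0))
  count-μ (suc k′) (divides (suc j) ℓ∸1≡) = ℕP.≤-antisym at-most at-least
    where
    k = suc k′
    geometric-root : F → Bool
    geometric-root x = eval (geometric k′ j) x ==F 0F
    at-most : countF (μ k) ≤ k
    at-most = ℕP.≤-trans
      (count-mono (λ x xᵏ≡1 → ==F-complete (trans (eval-unity-polynomial k′ x)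
          (trans (cong (_-F 1F) (==F-sound xᵏ≡1)) (polynomial-identity 0 (𝟙 ⊕ (⊝ 𝟙) , 𝟘) (λ _ → refl) [])))) (allFin ℓ))
      (subst (countF (λ x → eval (unity-polynomial k′) x ==F 0F) ≤_) (cong suc (ListP.length-replicate k′))
        (count-roots (unity-polynomial k′)))
    unit-splits : ∀ x → T (nonzero x) → T (μ k x ∨ geometric-root x)
    unit-splits x x≢0 = Equivalence.from T-∨ (Data.Sum.map
      (λ xᵏ-1≡0 → ==F-complete (difference-zero _ _ xᵏ-1≡0)) ==F-complete
      (zero-product (x ^F k -F 1F) _ (begin
        (x ^F k -F 1F) *F eval (geometric k′ j) x ≡⟨ geometric-identity k′ j x ⟩
        x ^F (suc j * k) -F 1F                    ≡⟨ cong (λ n → x ^F n -F 1F) (sym ℓ∸1≡) ⟩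
        x ^F (ℓ ∸ 1) -F 1F                        ≡⟨ cong (_-F 1F) (fermat x (≠F-sound x≢0)) ⟩
        1F -F 1F                                  ≡⟨ polynomial-identity 0 (𝟙 ⊕ (⊝ 𝟙) , 𝟘) (λ _ → refl) [] ⟩
        0F                                        ∎)))
      where open ≡-Reasoning
    at-least : k ≤ countF (μ k)
    at-least = ℕP.+-cancelʳ-≤ (j * k) k (countF (μ k)) (begin
      k + j * k                                     ≡⟨ sym ℓ∸1≡ ⟩
      ℓ ∸ 1                                         ≡⟨ sym count-nonzero ⟩
      countF nonzero                                ≤⟨ count-mono unit-splits (allFin ℓ) ⟩
      countF (λ x → μ k x ∨ geometric-root x)       ≤⟨ count-∨-≤ (μ k) geometric-root (allFin ℓ) ⟩
      countF (μ k) + countF geometric-root          ≤⟨ ℕP.+-monoʳ-≤ (countF (μ k))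
                                                         (subst (countF geometric-root ≤_) (geometric-length k′ j)
                                                           (count-roots (geometric k′ j))) ⟩
      countF (μ k) + j * k                          ∎)
      where open ℕP.≤-Reasoning

  μ-nonzero : ∀ {k x} → 0 < k → T (μ k x) → x ≢ 0F
  μ-nonzero {suc k′} _ xᵏ≡1 refl = 1F≢0F (trans (sym (==F-sound xᵏ≡1))
    (polynomial-identity 1 (λ p → (𝟘 ⊗ p) , 𝟘) (λ _ → refl) (0F ^F k′ ∷ [])))

  μ-one : ∀ k → T (μ k 1F)
  μ-one k = ==F-complete (1^F k)

  μ-* : ∀ k x y → T (μ k x) → T (μ k y) → T (μ k (x *F y))
  μ-* k x y xᵏ≡1 yᵏ≡1 = ==F-complete (begin
      (x *F y) ^F k       ≡⟨ *-^F x y k ⟩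
      x ^F k *F y ^F k    ≡⟨ cong₂ _*F_ (==F-sound xᵏ≡1) (==F-sound yᵏ≡1) ⟩
      1F *F 1F            ≡⟨ polynomial-identity 0 ((𝟙 ⊗ 𝟙) , 𝟙) (λ _ → refl) [] ⟩
      1F                  ∎)
    where open ≡-Reasoning

  μ-inverse : ∀ k x → T (μ k x) → T (μ k (inverse x))
  μ-inverse k x xᵏ≡1 = ==F-complete (begin
      (x ^F (ℓ ∸ 2)) ^F k  ≡⟨ sym (^F-* x (ℓ ∸ 2) k) ⟩
      x ^F ((ℓ ∸ 2) * k)   ≡⟨ cong (x ^F_) (ℕP.*-comm (ℓ ∸ 2) k) ⟩
      x ^F (k * (ℓ ∸ 2))   ≡⟨ ^F-* x k (ℓ ∸ 2) ⟩
      (x ^F k) ^F (ℓ ∸ 2)  ≡⟨ cong (_^F (ℓ ∸ 2)) (==F-sound xᵏ≡1) ⟩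
      1F ^F (ℓ ∸ 2)        ≡⟨ 1^F (ℓ ∸ 2) ⟩
      1F                   ∎)
    where open ≡-Reasoning

  μ-nontrivial : ∀ k → 2 ≤ k → k ∣ ℓ ∸ 1 → ∃ λ x → T (μ k x) × x ≢ 1F
  μ-nontrivial k 2≤k k∣ℓ∸1 with count-witness nontrivial (allFin ℓ) some-nontrivial
    where
    nontrivial : F → Bool
    nontrivial x = μ k x ∧ not (x ==F 1F)
    some-nontrivial : 0 < countF nontrivial
    some-nontrivial = ℕP.+-cancelˡ-≤ 1 1 (countF nontrivial) (begin
      2                                                       ≤⟨ 2≤k ⟩
      k                                                       ≡⟨ sym (count-μ k k∣ℓ∸1) ⟩
      countF (μ k)                                            ≡⟨ count-split (μ k) (_==F 1F) (allFin ℓ) ⟩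
      countF (λ x → μ k x ∧ (x ==F 1F)) + countF nontrivial   ≤⟨ ℕP.+-monoˡ-≤ (countF nontrivial)
                                                                   (ℕP.≤-trans (count-mono (λ x t → proj₂ (Equivalence.to T-∧ t)) (allFin ℓ))
                                                                     (ℕP.≤-reflexive (count-singleton 1F))) ⟩
      1 + countF nontrivial                                   ∎)
      where open ℕP.≤-Reasoning
  ... | x , _ , t = x , proj₁ (Equivalence.to T-∧ t) , ≠F-sound (proj₂ (Equivalence.to T-∧ t))


module Matrices (ℓ : ℕ) .{{ℓ≢0 : NonZero ℓ}} (ℓ-prime : Prime ℓ) where
  open Counting
  open import Data.Nat using (ℕ; suc; _+_; _*_; _∸_; _^_; NonZero)
  open import Data.Nat.Tactic.RingSolver using (solve-∀)
  open import Data.Nat.ListAction using (sum)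
  open import Data.Nat.Primality using (Prime)
  open import Data.Integer using (ℤ)
  open import Tactic.RingSolver.Core.Expression using (Expr; _⊕_; _⊗_; ⊝_)
  open import Data.Vec using ([]; _∷_)
  open import Data.Bool using (Bool; true; false; _∧_; T; if_then_else_)
  import Data.Bool.Properties as BoolP
  open import Data.List using (List; []; _∷_; map; concatMap; allFin)
  open import Data.List.Membership.Propositional using (_∈_; find)
  open import Data.List.Membership.Propositional.Properties using (∈-allFin; ∈-map⁺; ∈-map⁻; ∈-concatMap⁺; ∈-concatMap⁻)
  import Data.List.Relation.Unary.Any as Any
  open import Data.List.Relation.Unary.Unique.Propositional using (Unique)
  import Data.List.Relation.Unary.Unique.Propositional.Properties as Unique
  open import Data.Product using (_×_; _,_; proj₁; proj₂)
  open import Relation.Binary.PropositionalEquality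
  open import Relation.Nullary using (¬_)

  open PrimeField ℓ ℓ-prime public

  -- Matrices of polynomial expressions and their product, used to state
  -- entrywise identities between matrix products for the ring solver.
  MatExpr : ℕ → Set
  MatExpr n = Expr ℤ n × Expr ℤ n × Expr ℤ n × Expr ℤ n

  _⊙_ : ∀ {n} → MatExpr n → MatExpr n → MatExpr n
  (a , b , c , d) ⊙ (a′ , b′ , c′ , d′) =
    (a ⊗ a′ ⊕ b ⊗ c′) , (a ⊗ b′ ⊕ b ⊗ d′) , (c ⊗ a′ ⊕ d ⊗ c′) , (c ⊗ b′ ⊕ d ⊗ d′)

  entry₁ entry₂ entry₃ entry₄ : ∀ {n} → MatExpr n → Expr ℤ n
  entry₁ (a , _ , _ , _) = a
  entry₂ (_ , b , _ , _) = b
  entry₃ (_ , _ , c , _) = c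
  entry₄ (_ , _ , _ , d) = d


  M : Set
  M = Mat ℓ

  infixl 7 _·_
  _·_ : M → M → M
  _·_ = mul ℓ

  I : M
  I = idM ℓ

  mat-≡ : ∀ {a b c d a′ b′ c′ d′ : F} → a ≡ a′ → b ≡ b′ → c ≡ c′ → d ≡ d′ → mat a b c d ≡ mat a′ b′ c′ d′
  mat-≡ refl refl refl refl = refl

  ·-assoc : ∀ x y z → (x · y) · z ≡ x · (y · z)
  ·-assoc (mat a b c d) (mat e f g h) (mat i j k l) = mat-≡
    (polynomial-identity 12 (λ a b c d e f g h i j k l → entry₁ (((a , b , c , d) ⊙ (e , f , g , h)) ⊙ (i , j , k , l)) ,
                                                         entry₁ ((a , b , c , d) ⊙ ((e , f , g , h) ⊙ (i , j , k , l)))) (λ _ → refl) σ)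
    (polynomial-identity 12 (λ a b c d e f g h i j k l → entry₂ (((a , b , c , d) ⊙ (e , f , g , h)) ⊙ (i , j , k , l)) ,
                                                         entry₂ ((a , b , c , d) ⊙ ((e , f , g , h) ⊙ (i , j , k , l)))) (λ _ → refl) σ)
    (polynomial-identity 12 (λ a b c d e f g h i j k l → entry₃ (((a , b , c , d) ⊙ (e , f , g , h)) ⊙ (i , j , k , l)) ,
                                                         entry₃ ((a , b , c , d) ⊙ ((e , f , g , h) ⊙ (i , j , k , l)))) (λ _ → refl) σ)
    (polynomial-identity 12 (λ a b c d e f g h i j k l → entry₄ (((a , b , c , d) ⊙ (e , f , g , h)) ⊙ (i , j , k , l)) ,
                                                         entry₄ ((a , b , c , d) ⊙ ((e , f , g , h) ⊙ (i , j , k , l)))) (λ _ → refl) σ)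
    where σ = a ∷ b ∷ c ∷ d ∷ e ∷ f ∷ g ∷ h ∷ i ∷ j ∷ k ∷ l ∷ []

  ·-identityˡ : ∀ x → I · x ≡ x
  ·-identityˡ (mat a b c d) = mat-≡
    (polynomial-identity 4 (λ a b c d → entry₁ ((𝟙 , 𝟘 , 𝟘 , 𝟙) ⊙ (a , b , c , d)) , a) (λ _ → refl) σ)
    (polynomial-identity 4 (λ a b c d → entry₂ ((𝟙 , 𝟘 , 𝟘 , 𝟙) ⊙ (a , b , c , d)) , b) (λ _ → refl) σ)
    (polynomial-identity 4 (λ a b c d → entry₃ ((𝟙 , 𝟘 , 𝟘 , 𝟙) ⊙ (a , b , c , d)) , c) (λ _ → refl) σ)
    (polynomial-identity 4 (λ a b c d → entry₄ ((𝟙 , 𝟘 , 𝟘 , 𝟙) ⊙ (a , b , c , d)) , d) (λ _ → refl) σ)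
    where σ = a ∷ b ∷ c ∷ d ∷ []

  ·-identityʳ : ∀ x → x · I ≡ x
  ·-identityʳ (mat a b c d) = mat-≡
    (polynomial-identity 4 (λ a b c d → entry₁ ((a , b , c , d) ⊙ (𝟙 , 𝟘 , 𝟘 , 𝟙)) , a) (λ _ → refl) σ)
    (polynomial-identity 4 (λ a b c d → entry₂ ((a , b , c , d) ⊙ (𝟙 , 𝟘 , 𝟘 , 𝟙)) , b) (λ _ → refl) σ)
    (polynomial-identity 4 (λ a b c d → entry₃ ((a , b , c , d) ⊙ (𝟙 , 𝟘 , 𝟘 , 𝟙)) , c) (λ _ → refl) σ)
    (polynomial-identity 4 (λ a b c d → entry₄ ((a , b , c , d) ⊙ (𝟙 , 𝟘 , 𝟘 , 𝟙)) , d) (λ _ → refl) σ)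
    where σ = a ∷ b ∷ c ∷ d ∷ []

  diag : F → F → M
  diag a d = mat a 0F 0F d

  diag-· : ∀ a d a′ d′ → diag a d · diag a′ d′ ≡ diag (a *F a′) (d *F d′)
  diag-· a d a′ d′ = mat-≡
    (polynomial-identity 4 (λ a d a′ d′ → entry₁ ((a , 𝟘 , 𝟘 , d) ⊙ (a′ , 𝟘 , 𝟘 , d′)) , (a ⊗ a′)) (λ _ → refl) σ)
    (polynomial-identity 4 (λ a d a′ d′ → entry₂ ((a , 𝟘 , 𝟘 , d) ⊙ (a′ , 𝟘 , 𝟘 , d′)) , 𝟘) (λ _ → refl) σ)
    (polynomial-identity 4 (λ a d a′ d′ → entry₃ ((a , 𝟘 , 𝟘 , d) ⊙ (a′ , 𝟘 , 𝟘 , d′)) , 𝟘) (λ _ → refl) σ)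
    (polynomial-identity 4 (λ a d a′ d′ → entry₄ ((a , 𝟘 , 𝟘 , d) ⊙ (a′ , 𝟘 , 𝟘 , d′)) , (d ⊗ d′)) (λ _ → refl) σ)
    where σ = a ∷ d ∷ a′ ∷ d′ ∷ []

  scalar-central : ∀ s y x → (y · diag s s) · x ≡ diag s s · (y · x)
  scalar-central s (mat a b c d) (mat e f g h) = mat-≡
    (polynomial-identity 9 (λ s a b c d e f g h → entry₁ (((a , b , c , d) ⊙ (s , 𝟘 , 𝟘 , s)) ⊙ (e , f , g , h)) ,
                                                  entry₁ ((s , 𝟘 , 𝟘 , s) ⊙ ((a , b , c , d) ⊙ (e , f , g , h)))) (λ _ → refl) σ)
    (polynomial-identity 9 (λ s a b c d e f g h → entry₂ (((a , b , c , d) ⊙ (s , 𝟘 , 𝟘 , s)) ⊙ (e , f , g , h)) ,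
                                                  entry₂ ((s , 𝟘 , 𝟘 , s) ⊙ ((a , b , c , d) ⊙ (e , f , g , h)))) (λ _ → refl) σ)
    (polynomial-identity 9 (λ s a b c d e f g h → entry₃ (((a , b , c , d) ⊙ (s , 𝟘 , 𝟘 , s)) ⊙ (e , f , g , h)) ,
                                                  entry₃ ((s , 𝟘 , 𝟘 , s) ⊙ ((a , b , c , d) ⊙ (e , f , g , h)))) (λ _ → refl) σ)
    (polynomial-identity 9 (λ s a b c d e f g h → entry₄ (((a , b , c , d) ⊙ (s , 𝟘 , 𝟘 , s)) ⊙ (e , f , g , h)) ,
                                                  entry₄ ((s , 𝟘 , 𝟘 , s) ⊙ ((a , b , c , d) ⊙ (e , f , g , h)))) (λ _ → refl) σ)
    where σ = s ∷ a ∷ b ∷ c ∷ d ∷ e ∷ f ∷ g ∷ h ∷ []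

  conjugate-back : ∀ X Y g → Y · X ≡ I → Y · ((X · g) · Y) · X ≡ g
  conjugate-back X Y g yx = begin
      Y · ((X · g) · Y) · X ≡⟨ cong (_· X) (sym (·-assoc Y (X · g) Y)) ⟩
      Y · (X · g) · Y · X   ≡⟨ cong (λ w → w · Y · X) (sym (·-assoc Y X g)) ⟩
      Y · X · g · Y · X     ≡⟨ cong (λ w → w · g · Y · X) yx ⟩
      I · g · Y · X         ≡⟨ cong (λ w → w · Y · X) (·-identityˡ g) ⟩
      g · Y · X             ≡⟨ ·-assoc g Y X ⟩
      g · (Y · X)           ≡⟨ cong (g ·_) yx ⟩
      g · I                 ≡⟨ ·-identityʳ g ⟩
      g                     ∎
    where open ≡-Reasoning

  conjugate-· : ∀ X Y u v → Y · X ≡ I → (X · u · Y) · (X · v · Y) ≡ X · (u · v) · Y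
  conjugate-· X Y u v yx = begin
      (X · u · Y) · (X · v · Y) ≡⟨ ·-assoc (X · u) Y (X · v · Y) ⟩
      X · u · (Y · (X · v · Y)) ≡⟨ cong (X · u ·_) (sym (·-assoc Y (X · v) Y)) ⟩
      X · u · (Y · (X · v) · Y) ≡⟨ cong (λ w → X · u · (w · Y)) (sym (·-assoc Y X v)) ⟩
      X · u · (Y · X · v · Y)   ≡⟨ cong (λ w → X · u · (w · v · Y)) yx ⟩
      X · u · (I · v · Y)       ≡⟨ cong (λ w → X · u · (w · Y)) (·-identityˡ v) ⟩
      X · u · (v · Y)           ≡⟨ sym (·-assoc (X · u) v Y) ⟩
      X · u · v · Y             ≡⟨ cong (_· Y) (·-assoc X u v) ⟩
      X · (u · v) · Y           ∎
    where open ≡-Reasoning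

  countM : (M → Bool) → ℕ
  countM P = count P (allMat ℓ)

  card≡countM : ∀ P → card ℓ P ≡ countM P
  card≡countM P = go (allMat ℓ)
    where
    go : ∀ xs → countᵇ ℓ P xs ≡ count P xs
    go []       = refl
    go (x ∷ xs) with P x
    ... | true  = cong suc (go xs)
    ... | false = go xs

  private
    -- allMat = concatMap rows₁ (allFin ℓ), grouping the matrices by their entries.
    rows₃ : F → F → F → List M
    rows₃ a b c = map (mat a b c) (allFin ℓ)
    rows₂ : F → F → List M
    rows₂ a b = concatMap (rows₃ a b) (allFin ℓ)
    rows₁ : F → List M
    rows₁ a = concatMap (rows₂ a) (allFin ℓ)

    tag-concatMap : ∀ {B : Set} (f : F → List M) (t : M → B) s → (∀ z {y} → y ∈ f z → t y ≡ s) →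
                    ∀ {y} → y ∈ concatMap f (allFin ℓ) → t y ≡ s
    tag-concatMap f t s tags y∈ with find (∈-concatMap⁻ f {xs = allFin ℓ} y∈)
    ... | z , _ , y∈fz = tags z y∈fz

    tags₃ : ∀ a b c {y} → y ∈ rows₃ a b c → Mat.a y ≡ a × Mat.b y ≡ b × Mat.c y ≡ c
    tags₃ a b c y∈ with ∈-map⁻ (mat a b c) y∈
    ... | d , _ , refl = refl , refl , refl

  allMat-unique : Unique (allMat ℓ)
  allMat-unique = concatMap-unique rows₁ Mat.a (Unique.allFin⁺ ℓ)
    (λ a → concatMap-unique (rows₂ a) Mat.b (Unique.allFin⁺ ℓ)
      (λ b → concatMap-unique (rows₃ a b) Mat.c (Unique.allFin⁺ ℓ)
        (λ c → Unique.map⁺ (cong Mat.d) (Unique.allFin⁺ ℓ))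
        (λ c y∈ → proj₂ (proj₂ (tags₃ a b c y∈))))
      (λ b → tag-concatMap (rows₃ a b) Mat.b b (λ c y∈ → proj₁ (proj₂ (tags₃ a b c y∈)))))
    (λ a → tag-concatMap (rows₂ a) Mat.a a
      (λ b → tag-concatMap (rows₃ a b) Mat.a a (λ c y∈ → proj₁ (tags₃ a b c y∈))))

  allMat-complete : ∀ m → m ∈ allMat ℓ
  allMat-complete (mat a b c d) =
    ∈-concatMap⁺ rows₁ (Any.map (λ { refl →
    ∈-concatMap⁺ (rows₂ a) (Any.map (λ { refl →
    ∈-concatMap⁺ (rows₃ a b) (Any.map (λ { refl → ∈-map⁺ (mat a b c) (∈-allFin d) }) (∈-allFin c)) })
      (∈-allFin b)) }) (∈-allFin a))

  open OverUniverse (allMat ℓ) allMat-unique allMat-complete public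
    renaming (count-≥ to countM-≥; count-injection to countM-injection; count-bijection to countM-bijection)

  count-entrywise : ∀ P (A B C D : F → Bool) → (∀ a b c d → P (mat a b c d) ≡ A a ∧ (B b ∧ (C c ∧ D d))) →
                    countM P ≡ countF A * (countF B * (countF C * countF D))
  count-entrywise P A B C D P≡ = begin
      count P (concatMap rows₁ (allFin ℓ))              ≡⟨ count-concatMap P rows₁ (allFin ℓ) ⟩
      sum (map (λ a → count P (rows₁ a)) (allFin ℓ))    ≡⟨ sum-cong _ _ level₁ (allFin ℓ) ⟩
      sum (map (λ a → if A a then K₁ else 0) (allFin ℓ)) ≡⟨ sum-if A K₁ (allFin ℓ) ⟩
      countF A * K₁                                     ∎
    where
    open ≡-Reasoning
    K₃ = countF D
    K₂ = countF C * K₃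
    K₁ = countF B * K₂
    level₃ : ∀ a b c → count P (rows₃ a b c) ≡ (if (A a ∧ B b) ∧ C c then K₃ else 0)
    level₃ a b c = trans (count-map P (mat a b c) (allFin ℓ))
      (trans (count-cong (λ d → trans (P≡ a b c d)
               (trans (sym (BoolP.∧-assoc (A a) (B b) (C c ∧ D d))) (sym (BoolP.∧-assoc (A a ∧ B b) (C c) (D d)))))
               (allFin ℓ))
             (count-const-∧ ((A a ∧ B b) ∧ C c) D (allFin ℓ)))
    level₂ : ∀ a b → count P (rows₂ a b) ≡ (if A a ∧ B b then K₂ else 0)
    level₂ a b = trans (count-concatMap P (rows₃ a b) (allFin ℓ))
      (trans (sum-cong _ _ (level₃ a b) (allFin ℓ)) (sum-if-∧ (A a ∧ B b) C K₃ (allFin ℓ)))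
    level₁ : ∀ a → count P (rows₁ a) ≡ (if A a then K₁ else 0)
    level₁ a = trans (count-concatMap P (rows₂ a) (allFin ℓ))
      (trans (sum-cong _ _ (level₂ a) (allFin ℓ)) (sum-if-∧ (A a) B K₂ (allFin ℓ)))

  zero-*ˡ : ∀ x → 0F *F x ≡ 0F
  zero-*ˡ x = polynomial-identity 1 (λ x → (𝟘 ⊗ x) , 𝟘) (λ _ → refl) (x ∷ [])

  zero-*ʳ : ∀ x → x *F 0F ≡ 0F
  zero-*ʳ x = polynomial-identity 1 (λ x → (x ⊗ 𝟘) , 𝟘) (λ _ → refl) (x ∷ [])

  det-diag : ∀ a d → det ℓ (diag a d) ≡ a *F d
  det-diag a d = polynomial-identity 2 (λ a d → (a ⊗ d ⊕ (⊝ (𝟘 ⊗ 𝟘))) , (a ⊗ d)) (λ _ → refl) (a ∷ d ∷ [])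

  det-antidiag : ∀ b c → det ℓ (mat 0F b c 0F) ≡ -F (b *F c)
  det-antidiag b c = polynomial-identity 2 (λ b c → (𝟘 ⊗ 𝟘 ⊕ (⊝ (b ⊗ c))) , (⊝ (b ⊗ c))) (λ _ → refl) (b ∷ c ∷ [])

  -0F≡0F : -F 0F ≡ 0F
  -0F≡0F = polynomial-identity 0 ((⊝ 𝟘) , 𝟘) (λ _ → refl) []

  neg-zero : ∀ {u} → -F u ≡ 0F → u ≡ 0F
  neg-zero {u} -u≡0 = trans (polynomial-identity 1 (λ u → u , (⊝ (⊝ u))) (λ _ → refl) (u ∷ []))
                            (trans (cong -F_ -u≡0) -0F≡0F)

  Cs-sound : ∀ {a b c d} → T (isCsᵇ ℓ (mat a b c d)) → a ≢ 0F × b ≡ 0F × c ≡ 0F × d ≢ 0F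
  Cs-sound {a} {b} {c} {d} t with ∧-elim t
  ... | b≡0 , t′ with ∧-elim t′
  ...   | c≡0 , det≢0 = (λ { refl → ad≢0 (zero-*ˡ d) }) , ==F-sound b≡0 , ==F-sound c≡0 , (λ { refl → ad≢0 (zero-*ʳ a) })
    where
    ad≢0 : a *F d ≢ 0F
    ad≢0 ad≡0 = ≠F-sound det≢0
      (trans (cong₂ (λ b c → det ℓ (mat a b c d)) (==F-sound b≡0) (==F-sound c≡0)) (trans (det-diag a d) ad≡0))

  Cs-complete : ∀ {a d} → a ≢ 0F → d ≢ 0F → T (isCsᵇ ℓ (diag a d))
  Cs-complete {a} {d} a≢0 d≢0 = ∧-intro (==F-complete {0F} refl) (∧-intro (==F-complete {0F} refl)
    (≠F-complete (λ det≡0 → *-nonzero a≢0 d≢0 (trans (sym (det-diag a d)) det≡0))))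

  isAntiᵇ : M → Bool
  isAntiᵇ m = (Mat.a m ==F 0F) ∧ (Mat.d m ==F 0F) ∧ isGLᵇ ℓ m

  Anti-sound : ∀ {a b c d} → T (isAntiᵇ (mat a b c d)) → a ≡ 0F × b ≢ 0F × c ≢ 0F × d ≡ 0F
  Anti-sound {a} {b} {c} {d} t with ∧-elim t
  ... | a≡0 , t′ with ∧-elim t′
  ...   | d≡0 , det≢0 = ==F-sound a≡0 , (λ { refl → bc≢0 (zero-*ˡ c) }) , (λ { refl → bc≢0 (zero-*ʳ b) }) , ==F-sound d≡0
    where
    bc≢0 : b *F c ≢ 0F
    bc≢0 bc≡0 = ≠F-sound det≢0 (trans (cong₂ (λ a d → det ℓ (mat a b c d)) (==F-sound a≡0) (==F-sound d≡0))
                                       (trans (det-antidiag b c) (trans (cong -F_ bc≡0) -0F≡0F)))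

  Anti-complete : ∀ {b c} → b ≢ 0F → c ≢ 0F → T (isAntiᵇ (mat 0F b c 0F))
  Anti-complete {b} {c} b≢0 c≢0 = ∧-intro (==F-complete {0F} refl) (∧-intro (==F-complete {0F} refl)
    (≠F-complete (λ det≡0 → *-nonzero b≢0 c≢0 (neg-zero (trans (sym (det-antidiag b c)) det≡0)))))

  Cs-entrywise : ∀ a b c d → isCsᵇ ℓ (mat a b c d) ≡ nonzero a ∧ ((b ==F 0F) ∧ ((c ==F 0F) ∧ nonzero d))
  Cs-entrywise a b c d = T-ext
    (λ t → let (a≢0 , b≡0 , c≡0 , d≢0) = Cs-sound {a} {b} {c} {d} t in
           ∧⁴-intro (≠F-complete a≢0) (==F-complete b≡0) (==F-complete c≡0) (≠F-complete d≢0))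
    (λ t → let (a≢0 , b≡0 , c≡0 , d≢0) = ∧⁴-elim {nonzero a} {b ==F 0F} {c ==F 0F} {nonzero d} t in
           subst (λ m → T (isCsᵇ ℓ m)) (mat-≡ {a} {0F} {0F} {d} refl (sym (==F-sound b≡0)) (sym (==F-sound c≡0)) refl)
             (Cs-complete (≠F-sound a≢0) (≠F-sound d≢0)))

  Anti-entrywise : ∀ a b c d → isAntiᵇ (mat a b c d) ≡ (a ==F 0F) ∧ (nonzero b ∧ (nonzero c ∧ (d ==F 0F)))
  Anti-entrywise a b c d = T-ext
    (λ t → let (a≡0 , b≢0 , c≢0 , d≡0) = Anti-sound {a} {b} {c} {d} t in
           ∧⁴-intro (==F-complete a≡0) (≠F-complete b≢0) (≠F-complete c≢0) (==F-complete d≡0))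
    (λ t → let (a≡0 , b≢0 , c≢0 , d≡0) = ∧⁴-elim {a ==F 0F} {nonzero b} {nonzero c} {d ==F 0F} t in
           subst (λ m → T (isAntiᵇ m)) (mat-≡ {0F} {b} {c} {0F} (sym (==F-sound a≡0)) refl refl (sym (==F-sound d≡0)))
             (Anti-complete (≠F-sound b≢0) (≠F-sound c≢0)))

  count-Cs : countM (isCsᵇ ℓ) ≡ (ℓ ∸ 1) ^ 2
  count-Cs = begin
      countM (isCsᵇ ℓ)                                            ≡⟨ count-entrywise (isCsᵇ ℓ) nonzero (_==F 0F) (_==F 0F) nonzero Cs-entrywise ⟩
      countF nonzero * (countF (_==F 0F) * (countF (_==F 0F) * countF nonzero))
        ≡⟨ cong₂ _*_ count-nonzero (cong₂ _*_ (count-singleton 0F) (cong₂ _*_ (count-singleton 0F) count-nonzero)) ⟩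
      (ℓ ∸ 1) * (1 * (1 * (ℓ ∸ 1)))                               ≡⟨ arith (ℓ ∸ 1) ⟩
      (ℓ ∸ 1) ^ 2                                                 ∎
    where
    open ≡-Reasoning
    arith : ∀ m → m * (1 * (1 * m)) ≡ m * (m * 1)
    arith = solve-∀

  count-Anti : countM isAntiᵇ ≡ (ℓ ∸ 1) ^ 2
  count-Anti = begin
      countM isAntiᵇ                                              ≡⟨ count-entrywise isAntiᵇ (_==F 0F) nonzero nonzero (_==F 0F) Anti-entrywise ⟩
      countF (_==F 0F) * (countF nonzero * (countF nonzero * countF (_==F 0F)))
        ≡⟨ cong₂ _*_ (count-singleton 0F) (cong₂ _*_ count-nonzero (cong₂ _*_ count-nonzero (count-singleton 0F))) ⟩
      1 * ((ℓ ∸ 1) * ((ℓ ∸ 1) * 1))                               ≡⟨ arith (ℓ ∸ 1) ⟩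
      (ℓ ∸ 1) ^ 2                                                 ∎
    where
    open ≡-Reasoning
    arith : ∀ m → 1 * (m * (m * 1)) ≡ m * (m * 1)
    arith = solve-∀

  count-Ns : card ℓ (isNsᵇ ℓ) ≡ 2 * (ℓ ∸ 1) ^ 2
  count-Ns = begin
      card ℓ (isNsᵇ ℓ)                       ≡⟨ card≡countM (isNsᵇ ℓ) ⟩
      countM (isNsᵇ ℓ)                       ≡⟨ count-∨-disjoint (isCsᵇ ℓ) isAntiᵇ disjoint (allMat ℓ) ⟩
      countM (isCsᵇ ℓ) + countM isAntiᵇ     ≡⟨ cong₂ _+_ count-Cs count-Anti ⟩
      (ℓ ∸ 1) ^ 2 + (ℓ ∸ 1) ^ 2             ≡⟨ arith ((ℓ ∸ 1) ^ 2) ⟩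
      2 * (ℓ ∸ 1) ^ 2                        ∎
    where
    open ≡-Reasoning
    arith : ∀ n → n + n ≡ 2 * n
    arith = solve-∀
    disjoint : ∀ m → T (isCsᵇ ℓ m) → ¬ T (isAntiᵇ m)
    disjoint (mat a b c d) t u = proj₁ (proj₂ (Anti-sound {a} {b} {c} {d} u)) (proj₁ (proj₂ (Cs-sound {a} {b} {c} {d} t)))


module Lagrange (ℓ : ℕ) .{{ℓ≢0 : NonZero ℓ}} (ℓ-prime : Prime ℓ) where
  open Counting
  open import Data.Nat using (ℕ; zero; suc; _+_; _<_; _≤_; z≤n; s≤s; NonZero)
  import Data.Nat.Properties as ℕP
  open import Data.Nat.Divisibility using (_∣_; _∣0; ∣-refl; ∣m∣n⇒∣m+n)
  open import Data.Nat.Primality using (Prime)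
  open import Data.Bool using (Bool; _∧_; not; T)
  open import Data.Product using (_×_; _,_; ∃; proj₁; proj₂)
  open import Relation.Nullary using (¬_)
  open import Relation.Binary.PropositionalEquality

  open Matrices ℓ ℓ-prime

  Invertible : M → Set
  Invertible x = ∃ λ x⁻¹ → x · x⁻¹ ≡ I × x⁻¹ · x ≡ I

  module _ (H : M → Bool) (H-subgroup : IsSubgroupNs ℓ H) where
    open IsSubgroupNs H-subgroup

    -- The left coset x H, as a predicate in terms of x⁻¹: y ∈ x H iff x⁻¹ y ∈ H.
    coset : M → M → Bool
    coset x⁻¹ y = H (x⁻¹ · y)

    count-coset : ∀ x x⁻¹ → x · x⁻¹ ≡ I → x⁻¹ · x ≡ I → countM (coset x⁻¹) ≡ countM H
    count-coset x x⁻¹ xx⁻¹≡I x⁻¹x≡I = sym (countM-bijection (x ·_) (x⁻¹ ·_) (cancel x⁻¹ x x⁻¹x≡I) (cancel x x⁻¹ xx⁻¹≡I)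
      H (coset x⁻¹) (λ h h∈H → subst (λ z → T (H z)) (sym (cancel x⁻¹ x x⁻¹x≡I h)) h∈H) (λ y y∈xH → y∈xH))
      where
      cancel : ∀ u v → u · v ≡ I → ∀ y → u · (v · y) ≡ y
      cancel u v uv≡I y = trans (sym (·-assoc u v y)) (trans (cong (_· y) uv≡I) (·-identityˡ y))

    record CosetUnion (S : M → Bool) : Set where
      field
        invertible : ∀ x → T (S x) → Invertible x
        closed     : ∀ x h → T (S x) → T (H h) → T (S (x · h))

    _∖coset_ : (M → Bool) → M → M → Bool
    (S ∖coset x⁻¹) y = S y ∧ not (coset x⁻¹ y)

    remove-coset : ∀ S → CosetUnion S → ∀ x x⁻¹ → T (S x) → x · x⁻¹ ≡ I → x⁻¹ · x ≡ I →
                   CosetUnion (S ∖coset x⁻¹) × countM S ≡ countM H + countM (S ∖coset x⁻¹)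
    remove-coset S S-union x x⁻¹ x∈S xx⁻¹≡I x⁻¹x≡I = S′-union , |S|≡
      where
      open CosetUnion S-union
      S′ : M → Bool
      S′ = S ∖coset x⁻¹
      x·x⁻¹y≡y : ∀ y → x · (x⁻¹ · y) ≡ y
      x·x⁻¹y≡y y = trans (sym (·-assoc x x⁻¹ y)) (trans (cong (_· y) xx⁻¹≡I) (·-identityˡ y))
      coset⊆S : ∀ y → T (coset x⁻¹ y) → T (S y)
      coset⊆S y y∈xH = subst (λ z → T (S z)) (x·x⁻¹y≡y y) (closed x (x⁻¹ · y) x∈S y∈xH)
      |S|≡ : countM S ≡ countM H + countM S′
      |S|≡ = trans (count-split S (coset x⁻¹) (allMat ℓ))
        (cong (_+ countM S′) (trans (count-cong (λ y → T-ext (λ t → proj₂ (∧-elim t)) (λ t → ∧-intro (coset⊆S y t) t)) (allMat ℓ))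
                                    (count-coset x x⁻¹ xx⁻¹≡I x⁻¹x≡I)))
      S′-union : CosetUnion S′
      S′-union = record
        { invertible = λ y y∈S′ → invertible y (proj₁ (∧-elim y∈S′))
        ; closed     = λ y h y∈S′ h∈H → ∧-intro (closed y h (proj₁ (∧-elim y∈S′)) h∈H)
                                          (not-intro (not-in-coset y h (proj₂ (∧-elim y∈S′)) h∈H))
        }
        where
        -- If y h ∈ x H then y = (y h) h⁻¹ ∈ x H.
        not-in-coset : ∀ y h → T (not (coset x⁻¹ y)) → T (H h) → ¬ T (coset x⁻¹ (y · h))
        not-in-coset y h y∉xH h∈H yh∈xH with invCl h h∈H
        ... | h⁻¹ , h⁻¹∈H , hh⁻¹≡I = not-elim y∉xH
          (subst (λ z → T (H z)) back (mulCl (x⁻¹ · (y · h)) h⁻¹ yh∈xH h⁻¹∈H))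
          where
          back : x⁻¹ · (y · h) · h⁻¹ ≡ x⁻¹ · y
          back = trans (·-assoc x⁻¹ (y · h) h⁻¹)
                   (cong (x⁻¹ ·_) (trans (·-assoc y h h⁻¹) (trans (cong (y ·_) hh⁻¹≡I) (·-identityʳ y))))

    lagrange : ∀ S → CosetUnion S → countM H ∣ countM S
    lagrange S = go (countM S) S ℕP.≤-refl
      where
      |H|>0 : 0 < countM H
      |H|>0 = count-pos H (allMat-complete I) hasId
      go : ∀ N S → countM S ≤ N → CosetUnion S → countM H ∣ countM S
      go N S |S|≤N S-union with countM S in |S|≡
      ... | zero = countM H ∣0
      go zero    S () S-union | suc c
      go (suc N) S (s≤s c≤N) S-union | suc c
        with count-witness S (allMat ℓ) (subst (0 <_) (sym |S|≡) (s≤s z≤n))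
      ... | x , _ , x∈S with CosetUnion.invertible S-union x x∈S
      ...   | x⁻¹ , xx⁻¹≡I , x⁻¹x≡I = subst (countM H ∣_) (trans (sym split) |S|≡)
                                        (∣m∣n⇒∣m+n ∣-refl (go N S′ |S′|≤N S′-union))
        where
        S′ : M → Bool
        S′ = S ∖coset x⁻¹
        S′-union : CosetUnion S′
        S′-union = proj₁ (remove-coset S S-union x x⁻¹ x∈S xx⁻¹≡I x⁻¹x≡I)
        split : countM S ≡ countM H + countM S′
        split = proj₂ (remove-coset S S-union x x⁻¹ x∈S xx⁻¹≡I x⁻¹x≡I)
        |S′|≤N : countM S′ ≤ N
        |S′|≤N = ℕP.≤-pred (ℕP.≤-trans (ℕP.+-monoˡ-≤ (countM S′) |H|>0)
                   (ℕP.≤-trans (ℕP.≤-reflexive (trans (sym split) |S|≡)) (s≤s c≤N)))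


module Forward (ℓ : ℕ) .{{ℓ≢0 : NonZero ℓ}} (ℓ-prime : Prime ℓ) where
  open Counting
  open import Data.Nat using (ℕ; _∸_; _^_; _≤_; NonZero)
  open import Data.Nat.Divisibility using (_∣_)
  open import Data.Nat.Primality using (Prime)
  open import Data.Bool using (Bool; T)
  open import Data.Bool.Properties using (T?)
  open import Data.Fin.Properties using () renaming (_≟_ to _≟F_)
  open import Data.List using ([]; _∷_)
  open import Data.List.Membership.Propositional using (lose; find)
  open import Data.List.Relation.Unary.Any using (any?)
  open import Data.List.Relation.Unary.All using ([]; _∷_)
  open import Data.List.Relation.Unary.AllPairs using ([]; _∷_)
  open import Data.Product using (_×_; _,_; ∃)
  open import Relation.Nullary.Decidable using () renaming (_×-dec_ to _×?_)
  open import Data.Empty using (⊥-elim)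
  open import Relation.Binary.Definitions using (DecidableEquality)
  open import Relation.Binary.PropositionalEquality
  open import Relation.Nullary using (¬_; yes; no; ¬?)
  open import Relation.Nullary.Decidable using (map′)

  open Matrices ℓ ℓ-prime
  open Lagrange ℓ ℓ-prime

  Cs-· : ∀ x y → T (isCsᵇ ℓ x) → T (isCsᵇ ℓ y) → T (isCsᵇ ℓ (x · y))
  Cs-· (mat a b c d) (mat a′ b′ c′ d′) x∈Cs y∈Cs with Cs-sound {a} {b} {c} {d} x∈Cs | Cs-sound {a′} {b′} {c′} {d′} y∈Cs
  ... | a≢0 , refl , refl , d≢0 | a′≢0 , refl , refl , d′≢0 =
    subst (λ z → T (isCsᵇ ℓ z)) (sym (diag-· a d a′ d′)) (Cs-complete (*-nonzero a≢0 a′≢0) (*-nonzero d≢0 d′≢0))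

  Cs-invertible : ∀ x → T (isCsᵇ ℓ x) → Invertible x
  Cs-invertible (mat a b c d) x∈Cs with Cs-sound {a} {b} {c} {d} x∈Cs
  ... | a≢0 , refl , refl , d≢0 = diag (inverse a) (inverse d) ,
    trans (diag-· a d (inverse a) (inverse d)) (mat-≡ (inverseʳ a a≢0) refl refl (inverseʳ d d≢0)) ,
    trans (diag-· (inverse a) (inverse d) a d) (mat-≡ (inverseˡ a a≢0) refl refl (inverseˡ d d≢0))

  module Conjugated (G : M → Bool) (G-subgroup : IsSubgroupNs ℓ G) (X Y : M) (XY≡I : X · Y ≡ I) (YX≡I : Y · X ≡ I)
                    (into-Cs : ∀ g → T (G g) → T (isCsᵇ ℓ (X · g · Y))) where
    open IsSubgroupNs G-subgroup

    -- The conjugate X G X⁻¹, described through its preimage under conjugation.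
    H : M → Bool
    H h = G (Y · h · X)

    H⊆Cs : ∀ h → T (H h) → T (isCsᵇ ℓ h)
    H⊆Cs h h∈H = subst (λ z → T (isCsᵇ ℓ z)) (conjugate-back Y X h XY≡I) (into-Cs (Y · h · X) h∈H)

    H-subgroup : IsSubgroupNs ℓ H
    H-subgroup = record
      { ⊆Ns   = λ h h∈H → ∨-introˡ (H⊆Cs h h∈H)
      ; hasId = subst (λ z → T (G z)) (sym (trans (cong (_· X) (·-identityʳ Y)) YX≡I)) hasId
      ; mulCl = λ u v u∈H v∈H → subst (λ z → T (G z)) (conjugate-· Y X u v XY≡I) (mulCl (Y · u · X) (Y · v · X) u∈H v∈H)
      ; invCl = inverse-in-H
      }
      where
      inverse-in-H : ∀ h → T (H h) → ∃ λ h′ → T (H h′) × h · h′ ≡ I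
      inverse-in-H h h∈H with invCl (Y · h · X) h∈H
      ... | g′ , g′∈G , gg′≡I = X · g′ · Y ,
        subst (λ z → T (G z)) (sym (conjugate-back X Y g′ YX≡I)) g′∈G ,
        (begin
          h · (X · g′ · Y)                     ≡⟨ cong (_· (X · g′ · Y)) (sym (conjugate-back Y X h XY≡I)) ⟩
          (X · (Y · h · X) · Y) · (X · g′ · Y) ≡⟨ conjugate-· X Y (Y · h · X) g′ YX≡I ⟩
          X · (Y · h · X · g′) · Y             ≡⟨ cong (λ w → X · w · Y) gg′≡I ⟩
          X · I · Y                            ≡⟨ cong (_· Y) (·-identityʳ X) ⟩
          X · Y                                ≡⟨ XY≡I ⟩
          I                                    ∎)
        where open ≡-Reasoning

    count-H : countM H ≡ countM G
    count-H = countM-bijection (λ h → Y · h · X) (λ g → X · g · Y)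
      (λ h → conjugate-back Y X h XY≡I) (λ g → conjugate-back X Y g YX≡I)
      H G (λ h h∈H → h∈H) (λ g g∈G → subst (λ z → T (G z)) (sym (conjugate-back X Y g YX≡I)) g∈G)

  -- A subgroup conjugate into C_s(ℓ) has order dividing (ℓ - 1)²: its
  -- conjugate lies in C_s(ℓ), which is a union of cosets of it.
  order-divides : ∀ G → IsSubgroupNs ℓ G → ConjInto ℓ G (isCsᵇ ℓ) → countM G ∣ (ℓ ∸ 1) ^ 2
  order-divides G G-subgroup (X , Y , XY≡I , YX≡I , into-Cs) =
    subst₂ _∣_ count-H count-Cs
      (lagrange H H-subgroup (isCsᵇ ℓ) (record { invertible = Cs-invertible
                                                ; closed = λ x h x∈Cs h∈H → Cs-· x h x∈Cs (H⊆Cs h h∈H) }))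
    where open Conjugated G G-subgroup X Y XY≡I YX≡I into-Cs

  _≟M_ : DecidableEquality M
  mat a b c d ≟M mat a′ b′ c′ d′ =
    map′ (λ (a≡ , b≡ , c≡ , d≡) → mat-≡ a≡ b≡ c≡ d≡) (λ { refl → refl , refl , refl , refl })
         ((a ≟F a′) ×? ((b ≟F b′) ×? ((c ≟F c′) ×? (d ≟F d′))))

  I∈Z : T (isZᵇ ℓ I)
  I∈Z = ∧-intro (Cs-complete 1F≢0F 1F≢0F) (==F-complete {1F} refl)

  -- A subgroup not conjugate into the scalars has at least two elements:
  -- otherwise it is {I}, which lies in Z(ℓ) already.
  order-≥2 : ∀ G → IsSubgroupNs ℓ G → ¬ ConjInto ℓ G (isZᵇ ℓ) → 2 ≤ countM G
  order-≥2 G G-subgroup not-scalar with any? (λ g → T? (G g) ×? ¬? (g ≟M I)) (allMat ℓ)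
  ... | yes some-g = let (g , _ , g∈G , g≢I) = find some-g in
        countM-≥ G (I ∷ g ∷ []) (((λ I≡g → g≢I (sym I≡g)) ∷ []) ∷ [] ∷ []) (IsSubgroupNs.hasId G-subgroup ∷ g∈G ∷ [])
  ... | no  no-g   = ⊥-elim (not-scalar (I , I , ·-identityˡ I , ·-identityˡ I , λ g g∈G →
          subst (λ z → T (isZᵇ ℓ z)) (sym (trans (cong (_· I) (·-identityˡ g)) (trans (·-identityʳ g) (g≡I g g∈G)))) I∈Z))
    where
    g≡I : ∀ g → T (G g) → g ≡ I
    g≡I g g∈G with g ≟M I
    ... | yes g≡I = g≡I
    ... | no  g≢I = ⊥-elim (no-g (lose (allMat-complete g) (g∈G , g≢I)))


module Backward (ℓ : ℕ) .{{ℓ≢0 : NonZero ℓ}} (ℓ-prime : Prime ℓ) where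
  open Counting
  open import Data.Nat using (ℕ; _*_; _∸_; _<_; _≤_; NonZero)
  import Data.Nat.Properties as ℕP
  open import Data.Nat.Divisibility using (_∣_)
  open import Data.Nat.Primality using (Prime)
  open import Data.Bool using (Bool; _∧_; T)
  open import Data.Product using (_×_; _,_; ∃)
  open import Data.Sum using (_⊎_; inj₁; inj₂)
  open import Relation.Binary.PropositionalEquality
  open import Relation.Nullary using (¬_)

  open Matrices ℓ ℓ-prime
  open RootsOfUnity ℓ ℓ-prime

  scalar-form : ∀ S → T (isZᵇ ℓ S) → S ≡ diag (Mat.a S) (Mat.a S)
  scalar-form (mat a b c d) S∈Z with ∧-elim {isCsᵇ ℓ (mat a b c d)} S∈Z
  ... | S∈Cs , a≡d with Cs-sound {a} {b} {c} {d} S∈Cs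
  ...   | _ , b≡0 , c≡0 , _ = mat-≡ refl b≡0 c≡0 (sym (==F-sound a≡d))

  -- A subset containing a non-scalar matrix is not conjugate into Z(ℓ): the
  -- conjugate of a scalar matrix is the same scalar matrix.
  not-conjugate-scalar : ∀ G g → T (G g) → Mat.a g ≢ Mat.d g → ¬ ConjInto ℓ G (isZᵇ ℓ)
  not-conjugate-scalar G g g∈G a≢d (X , Y , XY≡I , YX≡I , into-Z) = a≢d (trans (cong Mat.a g≡sI) (sym (cong Mat.d g≡sI)))
    where
    S = X · g · Y
    s = Mat.a S
    g≡sI : g ≡ diag s s
    g≡sI = begin
      g                     ≡⟨ sym (conjugate-back X Y g YX≡I) ⟩
      Y · S · X             ≡⟨ cong (λ w → Y · w · X) (scalar-form S (into-Z g g∈G)) ⟩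
      Y · diag s s · X      ≡⟨ scalar-central s Y X ⟩
      diag s s · (Y · X)    ≡⟨ cong (diag s s ·_) YX≡I ⟩
      diag s s · I          ≡⟨ ·-identityʳ (diag s s) ⟩
      diag s s              ∎
      where open ≡-Reasoning

  Diag : ℕ → ℕ → M → Bool
  Diag k₁ k₂ m = μ k₁ (Mat.a m) ∧ ((Mat.b m ==F 0F) ∧ ((Mat.c m ==F 0F) ∧ μ k₂ (Mat.d m)))

  module DiagonalSubgroup (k₁ k₂ : ℕ) (k₁∣ : k₁ ∣ ℓ ∸ 1) (k₂∣ : k₂ ∣ ℓ ∸ 1) where

    k₁>0 : 0 < k₁
    k₁>0 = divisor-positive k₁∣

    k₂>0 : 0 < k₂
    k₂>0 = divisor-positive k₂∣

    Diag-sound : ∀ {a b c d} → T (Diag k₁ k₂ (mat a b c d)) → T (μ k₁ a) × b ≡ 0F × c ≡ 0F × T (μ k₂ d)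
    Diag-sound {a} {b} {c} {d} t with ∧⁴-elim {μ k₁ a} {b ==F 0F} {c ==F 0F} {μ k₂ d} t
    ... | a∈μ , b≡0 , c≡0 , d∈μ = a∈μ , ==F-sound b≡0 , ==F-sound c≡0 , d∈μ

    Diag-complete : ∀ {a d} → T (μ k₁ a) → T (μ k₂ d) → T (Diag k₁ k₂ (diag a d))
    Diag-complete a∈μ d∈μ = ∧⁴-intro a∈μ (==F-complete {0F} refl) (==F-complete {0F} refl) d∈μ

    Diag⊆Cs : ∀ g → T (Diag k₁ k₂ g) → T (isCsᵇ ℓ g)
    Diag⊆Cs (mat a b c d) g∈Diag with Diag-sound {a} {b} {c} {d} g∈Diag
    ... | a∈μ , refl , refl , d∈μ = Cs-complete (μ-nonzero k₁>0 a∈μ) (μ-nonzero k₂>0 d∈μ)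

    Diag-subgroup : IsSubgroupNs ℓ (Diag k₁ k₂)
    Diag-subgroup = record
      { ⊆Ns   = λ g g∈Diag → ∨-introˡ (Diag⊆Cs g g∈Diag)
      ; hasId = Diag-complete (μ-one k₁) (μ-one k₂)
      ; mulCl = closed-·
      ; invCl = closed-inverse
      }
      where
      closed-· : ∀ g h → T (Diag k₁ k₂ g) → T (Diag k₁ k₂ h) → T (Diag k₁ k₂ (g · h))
      closed-· (mat a b c d) (mat a′ b′ c′ d′) g∈Diag h∈Diag with Diag-sound {a} {b} {c} {d} g∈Diag | Diag-sound {a′} {b′} {c′} {d′} h∈Diag
      ... | a∈μ , refl , refl , d∈μ | a′∈μ , refl , refl , d′∈μ =
        subst (λ z → T (Diag k₁ k₂ z)) (sym (diag-· a d a′ d′))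
          (Diag-complete (μ-* k₁ a a′ a∈μ a′∈μ) (μ-* k₂ d d′ d∈μ d′∈μ))
      closed-inverse : ∀ g → T (Diag k₁ k₂ g) → ∃ λ h → T (Diag k₁ k₂ h) × g · h ≡ I
      closed-inverse (mat a b c d) g∈Diag with Diag-sound {a} {b} {c} {d} g∈Diag
      ... | a∈μ , refl , refl , d∈μ = diag (inverse a) (inverse d) ,
        Diag-complete (μ-inverse k₁ a a∈μ) (μ-inverse k₂ d d∈μ) ,
        trans (diag-· a d (inverse a) (inverse d))
              (mat-≡ (inverseʳ a (μ-nonzero k₁>0 a∈μ)) refl refl (inverseʳ d (μ-nonzero k₂>0 d∈μ)))

    count-Diag : card ℓ (Diag k₁ k₂) ≡ k₁ * k₂
    count-Diag = begin
      card ℓ (Diag k₁ k₂)                                                  ≡⟨ card≡countM (Diag k₁ k₂) ⟩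
      countM (Diag k₁ k₂)                                                  ≡⟨ count-entrywise (Diag k₁ k₂) (μ k₁) (_==F 0F) (_==F 0F) (μ k₂) (λ a b c d → refl) ⟩
      countF (μ k₁) * (countF (_==F 0F) * (countF (_==F 0F) * countF (μ k₂))) ≡⟨ cong₂ _*_ (count-μ k₁ k₁∣)
                                                                               (cong₂ _*_ (count-singleton 0F) (cong₂ _*_ (count-singleton 0F) (count-μ k₂ k₂∣))) ⟩
      k₁ * (1 * (1 * k₂))                                                  ≡⟨ cong (k₁ *_) (trans (ℕP.*-identityˡ _) (ℕP.*-identityˡ k₂)) ⟩
      k₁ * k₂                                                              ∎
      where open ≡-Reasoning

    Diag-belongs : 2 ≤ k₁ ⊎ 2 ≤ k₂ → BelongsCs ℓ (Diag k₁ k₂)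
    Diag-belongs nontrivial = into-Cs , not-scalar nontrivial
      where
      into-Cs : ConjInto ℓ (Diag k₁ k₂) (isCsᵇ ℓ)
      into-Cs = I , I , ·-identityˡ I , ·-identityˡ I ,
        λ g g∈Diag → subst (λ z → T (isCsᵇ ℓ z)) (sym (trans (cong (_· I) (·-identityˡ g)) (·-identityʳ g))) (Diag⊆Cs g g∈Diag)
      not-scalar : 2 ≤ k₁ ⊎ 2 ≤ k₂ → ¬ ConjInto ℓ (Diag k₁ k₂) (isZᵇ ℓ)
      not-scalar (inj₁ 2≤k₁) with μ-nontrivial k₁ 2≤k₁ k₁∣
      ... | x , x∈μ , x≢1 = not-conjugate-scalar (Diag k₁ k₂) (diag x 1F) (Diag-complete x∈μ (μ-one k₂)) x≢1
      not-scalar (inj₂ 2≤k₂) with μ-nontrivial k₂ 2≤k₂ k₂∣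
      ... | x , x∈μ , x≢1 = not-conjugate-scalar (Diag k₁ k₂) (diag 1F x) (Diag-complete (μ-one k₁) x∈μ) (λ 1≡x → x≢1 (sym 1≡x))


module Arithmetic where
  open import Data.Nat using (ℕ; zero; suc; _*_; _^_; _<_; _≤_; z≤n; s≤s; NonZero; >-nonZero; ≢-nonZero; nonTrivial⇒n>1)
  import Data.Nat.Properties as ℕP
  open import Data.Nat.DivMod using (_/_; m*[n/m]≡n; m/n*n≡m; m*n/n≡m)
  open import Data.Nat.Divisibility using (_∣_; divides; ∣-trans; *-cancelˡ-∣; m∣m*n; ∣n⇒∣m*n; quotient)
  open import Data.Nat.GCD using (gcd; gcd[m,n]∣m; gcd[m,n]∣n; gcd[m,n]≢0)
  open import Data.Nat.Coprimality using (coprime-/gcd; coprime-divisor)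
  open import Data.Nat.Primality using (Prime; euclidsLemma; prime⇒nonZero; prime⇒nonTrivial)
  open import Data.Nat.Primality.Factorisation using (factorise; PrimeFactorisation)
  open import Data.Nat.ListAction using (product)
  open import Data.Nat.Tactic.RingSolver using (solve-∀)
  open import Data.List using ([]; _∷_)
  open import Data.List.Relation.Unary.All using (All; _∷_)
  open import Data.Product using (_×_; _,_; ∃; ∃₂; Σ; proj₁; proj₂)
  open import Data.Sum using (_⊎_; inj₁; inj₂)
  open import Data.Empty using (⊥-elim)
  open import Relation.Binary.PropositionalEquality

  -- Every divisor d of m² is a product d₁ d₂ of two divisors of m
  -- (take d₁ = gcd(d, m); then d/d₁ is coprime to m/d₁ and divides m (m/d₁)).
  square-divisor-split : ∀ d m → 0 < m → d ∣ m * m → ∃₂ λ d₁ d₂ → d ≡ d₁ * d₂ × d₁ ∣ m × d₂ ∣ m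
  square-divisor-split d m (s≤s z≤n) d∣m² = g , d / g , sym g[d/g]≡d , gcd[m,n]∣n d m , d/g∣m
    where
    g = gcd d m
    instance
      g≢0 : NonZero g
      g≢0 = ≢-nonZero (gcd[m,n]≢0 d m (inj₂ (λ ())))
    g[m/g]≡m : g * (m / g) ≡ m
    g[m/g]≡m = m*[n/m]≡n (gcd[m,n]∣n d m)
    g[d/g]≡d : g * (d / g) ≡ d
    g[d/g]≡d = m*[n/m]≡n (gcd[m,n]∣m d m)
    regroup : ∀ g m → (g * m) * (g * m) ≡ g * (m * (g * m))
    regroup = solve-∀
    d/g∣m[m/g] : d / g ∣ (m / g) * (g * (m / g))
    d/g∣m[m/g] = *-cancelˡ-∣ g (subst₂ _∣_ (sym g[d/g]≡d)
                   (trans (cong (λ w → w * w) (sym g[m/g]≡m)) (regroup g (m / g))) d∣m²)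
    d/g∣m : d / g ∣ m
    d/g∣m = subst (d / g ∣_) g[m/g]≡m (coprime-divisor (coprime-/gcd d m) d/g∣m[m/g])

  prime-factor : ∀ h → 2 ≤ h → ∃ λ q → Prime q × q ∣ h
  prime-factor h 2≤h = first-factor (PrimeFactorisation.factors pf) (PrimeFactorisation.isFactorisation pf)
                                    (PrimeFactorisation.factorsPrime pf)
    where
    instance
      h≢0 : NonZero h
      h≢0 = >-nonZero (ℕP.<-trans (s≤s z≤n) 2≤h)
    pf = factorise h
    first-factor : ∀ fs → h ≡ product fs → All Prime fs → ∃ λ q → Prime q × q ∣ h
    first-factor []       h≡1 _          = ⊥-elim (ℕP.<-irrefl refl (subst (1 <_) h≡1 2≤h))
    first-factor (p ∷ ps) h≡  (p-prime ∷ _) = p , p-prime , divides (product ps) (trans h≡ (ℕP.*-comm p (product ps)))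

  AdmissibleIndex : ℕ → ℕ → Set
  AdmissibleIndex m n = 0 < n × 2 ∣ n × ∃ λ q → Σ (Prime q) λ q-prime → q ∣ m ×
                          n ∣ _/_ (2 * m ^ 2) q {{prime⇒nonZero q-prime}}

  -- If n h = 2m² for a divisor h ≥ 2 of m², then n is admissible:
  -- n = 2 (m²/h) is even, and n divides 2m²/q for any prime factor q of h.
  admissible-from-order : ∀ m h n → 0 < m → h ∣ m ^ 2 → 2 ≤ h → n * h ≡ 2 * m ^ 2 → AdmissibleIndex m n
  admissible-from-order m h n (s≤s z≤n) (divides t m²≡th) 2≤h nh≡2m² = 0<n , divides t n≡t2 , q , q-prime , q∣m , n∣2m²/q
    where
    instance
      h≢0 : NonZero h
      h≢0 = >-nonZero (ℕP.<-trans (s≤s z≤n) 2≤h)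
    regroup : ∀ t h → 2 * (t * h) ≡ (2 * t) * h
    regroup = solve-∀
    n≡2t : n ≡ 2 * t
    n≡2t = ℕP.*-cancelʳ-≡ n (2 * t) h (trans nh≡2m² (trans (cong (2 *_) m²≡th) (regroup t h)))
    n≡t2 : n ≡ t * 2
    n≡t2 = trans n≡2t (ℕP.*-comm 2 t)
    0<n : 0 < n
    0<n = ℕP.n≢0⇒n>0 (λ n≡0 → ℕP.1+n≢0 (sym (trans (cong (_* h) (sym n≡0)) nh≡2m²)))
    q-factor = prime-factor h 2≤h
    q = proj₁ q-factor
    q-prime = proj₁ (proj₂ q-factor)
    q∣h = proj₂ (proj₂ q-factor)
    instance
      q≢0 : NonZero q
      q≢0 = prime⇒nonZero q-prime
    q∣m : q ∣ m
    q∣m with euclidsLemma m (m * 1) q-prime (∣-trans q∣h (divides t m²≡th))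
    ... | inj₁ q∣m  = q∣m
    ... | inj₂ q∣m1 = subst (q ∣_) (ℕP.*-identityʳ m) q∣m1
    n∣2m²/q : n ∣ (2 * m ^ 2) / q
    n∣2m²/q = subst (n ∣_) 2m²/q≡ (m∣m*n (quotient q∣h))
      where
      regroup′ : ∀ n h q → n * (h * q) ≡ (n * h) * q
      regroup′ = solve-∀
      2m²/q≡ : n * quotient q∣h ≡ (2 * m ^ 2) / q
      2m²/q≡ = sym (trans (cong (_/ q) (trans (sym nh≡2m²) (trans (cong (n *_) (_∣_.equality q∣h))
                                                                  (regroup′ n (quotient q∣h) q))))
                          (m*n/n≡m (n * quotient q∣h) q))

  factor-≥2 : ∀ d₁ d₂ → 2 ≤ d₁ * d₂ → 2 ≤ d₁ ⊎ 2 ≤ d₂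
  factor-≥2 (suc zero)    d₂ 2≤d₂ = inj₂ (subst (2 ≤_) (ℕP.*-identityˡ d₂) 2≤d₂)
  factor-≥2 (suc (suc _)) _  _    = inj₁ (s≤s (s≤s z≤n))

  -- Conversely, an admissible index is 2m² / (d₁ d₂) for divisors d₁, d₂ of m,
  -- not both 1: write n = 2s and 2m²/q = r n; then d = r q divides m² and
  -- n d = 2m², and d ≥ q ≥ 2 splits as d₁ d₂.
  order-from-admissible : ∀ m n → 0 < m → AdmissibleIndex m n →
    ∃₂ λ d₁ d₂ → d₁ ∣ m × d₂ ∣ m × (2 ≤ d₁ ⊎ 2 ≤ d₂) × n * (d₁ * d₂) ≡ 2 * m ^ 2
  order-from-admissible m n 0<m@(s≤s z≤n) (_ , divides s n≡s2 , q , q-prime , q∣m , divides r D≡rn) =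
    let (d₁ , d₂ , d≡ , d₁∣m , d₂∣m) = square-divisor-split (r * q) m 0<m d∣m² in
    d₁ , d₂ , d₁∣m , d₂∣m , factor-≥2 d₁ d₂ (subst (2 ≤_) d≡ 2≤d) , trans (cong (n *_) (sym d≡)) nd≡2m²
    where
    instance
      q≢0 : NonZero q
      q≢0 = prime⇒nonZero q-prime
    regroup₁ : ∀ r s q → r * (s * 2) * q ≡ 2 * (s * (r * q))
    regroup₁ = solve-∀
    regroup₂ : ∀ s r q → (s * 2) * (r * q) ≡ 2 * (s * (r * q))
    regroup₂ = solve-∀
    2m²≡ : 2 * m ^ 2 ≡ 2 * (s * (r * q))
    2m²≡ = trans (sym (m/n*n≡m (∣-trans q∣m (∣n⇒∣m*n 2 (m∣m*n (m * 1))))))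
                 (trans (cong (_* q) (trans D≡rn (cong (r *_) n≡s2))) (regroup₁ r s q))
    d∣m² : r * q ∣ m * m
    d∣m² = divides s (trans (cong (m *_) (sym (ℕP.*-identityʳ m))) (ℕP.*-cancelˡ-≡ (m ^ 2) _ 2 2m²≡))
    nd≡2m² : n * (r * q) ≡ 2 * m ^ 2
    nd≡2m² = trans (cong (_* (r * q)) n≡s2) (trans (regroup₂ s r q) (sym 2m²≡))
    r≢0 : r ≢ 0
    r≢0 refl = ℕP.1+n≢0 (trans 2m²≡ (cong (2 *_) (ℕP.*-zeroʳ s)))
    2≤d : 2 ≤ r * q
    2≤d = ℕP.≤-trans (nonTrivial⇒n>1 q {{prime⇒nonTrivial q-prime}}) (ℕP.m≤n*m q r {{≢-nonZero r≢0}})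


open import Data.Nat using (ℕ; _*_; _∸_; _^_; _<_; _≤_; NonZero)
open import Data.Nat.DivMod using (_/_)
open import Data.Nat.Divisibility using (_∣_)
open import Data.Nat.Primality using (Prime; prime⇒nonZero)
open import Data.Product using (_×_; _,_; ∃; Σ)
open import Function.Bundles using (_⇔_; mk⇔)
open import Relation.Nullary using (¬_)
open import Relation.Binary.PropositionalEquality using (subst; trans; sym; cong)
open Arithmetic using (AdmissibleIndex; admissible-from-order; order-from-admissible)

lemma3p13 : (ℓ : ℕ) .{{_ : NonZero ℓ}} → Prime ℓ → ¬ (2 ∣ ℓ) → (n : ℕ) →
    (∃ λ G → IsSubgroupNs ℓ G × BelongsCs ℓ G × IndexNs ℓ G n)
    ⇔ (0 < n × 2 ∣ n × ∃ λ q → Σ (Prime q) λ pq → q ∣ ℓ ∸ 1 ×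
    n ∣ _/_ (2 * (ℓ ∸ 1) ^ 2) q {{prime⇒nonZero pq}})
lemma3p13 ℓ ℓ-prime _ n = mk⇔ index-admissible admissible-index
  where
  open Matrices ℓ ℓ-prime
  open RootsOfUnity ℓ ℓ-prime using (ℓ∸1>0)
  open Forward ℓ ℓ-prime
  open Backward ℓ ℓ-prime

  index-admissible : (∃ λ G → IsSubgroupNs ℓ G × BelongsCs ℓ G × IndexNs ℓ G n) → AdmissibleIndex (ℓ ∸ 1) n
  index-admissible (G , G-subgroup , (into-Cs , not-scalar) , n|G|≡|Ns|) =
    admissible-from-order (ℓ ∸ 1) (card ℓ G) n ℓ∸1>0
      (subst (_∣ (ℓ ∸ 1) ^ 2) (sym (card≡countM G)) (order-divides G G-subgroup into-Cs))
      (subst (2 ≤_) (sym (card≡countM G)) (order-≥2 G G-subgroup not-scalar))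
      (trans n|G|≡|Ns| count-Ns)

  admissible-index : AdmissibleIndex (ℓ ∸ 1) n → ∃ λ G → IsSubgroupNs ℓ G × BelongsCs ℓ G × IndexNs ℓ G n
  admissible-index admissible =
    let (d₁ , d₂ , d₁∣ , d₂∣ , nontrivial , n[d₁d₂]≡) = order-from-admissible (ℓ ∸ 1) n ℓ∸1>0 admissible
        open DiagonalSubgroup d₁ d₂ d₁∣ d₂∣
    in Diag d₁ d₂ , Diag-subgroup , Diag-belongs nontrivial ,
       trans (cong (n *_) count-Diag) (trans n[d₁d₂]≡ (sym count-Ns))
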